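{- Let $1\le k<n$. The noncrossing complex $\Delta^{NC}_{k,n}$ has the following properties. (i) The map $(i_1,\dots,i_k)\mapsto(n+1-i_k,\dots,n+1-i_1)$ induces an automorphism of $\Delta^{NC}_{k,n}$. (ii) The map $I\mapsto[n]\setminus I$ induces an isomorphism $\Delta^{NC}_{k,n}\to\Delta^{NC}_{n-k,n}$. (iii) $I,J\in V_{k,n}$ are noncrossing if and only if they are noncrossing when restricted to the symmetric difference $I\triangle J=(I\cup J)\setminus(I\cap J)$, i.e. if and only if $I\setminus J$ and $J\setminus I$, viewed as equal-size subsets of the totally ordered set $I\triangle J$ (identified order-preservingly with $[|I\triangle J|]$), are noncrossing. (iv) For $b\in[n]$, the restriction of $\Delta^{NC}_{k,n}$ to the vertices $I$ with $b\in I$ is isomorphic to $\Delta^{NC}_{k-1,n-1}$, and the restriction to the vertices $I$ with $b\notin I$ is isomorphic to $\Delta^{NC}_{k,n-1}$ (via deleting $b$ and relabelling $[n]\setminus\{b\}$ order-preservingly as $[n-1]$). (v) The $n$ cyclic intervals $\{c,c+1,\dots,c+k-1\}$ (entries modulo $n$, $c\in[n]$) do not cross any vertex of $V_{k,n}$, and hence are contained in every maximal face of $\Delta^{NC}_{k,n}$.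
   Context: For integers $1\le k<n$ (and, where needed, the degenerate cases $k=0$ or $k=n$ with the obvious conventions), $V_{k,n}$ is the set of strictly increasing vectors $(i_1,\dots,i_k)$ with entries in $[n]$, identified with $k$-subsets of $[n]$. Two arcs $(p<p')$ and $(q<q')$ cross if $p<q<p'<q'$ or $q<p<q'<p'$. Two vectors $I,J\in V_{k,n}$ are noncrossing if for all indices $1\le a<b\le k$ such that $i_\ell=j_\ell$ for all $a<\ell<b$, the arcs $(i_a<i_b)$ and $(j_a<j_b)$ do not cross. The noncrossing complex $\Delta^{NC}_{k,n}$ is the flag simplicial complex with vertex set $V_{k,n}$ whose faces are sets of pairwise noncrossing vectors. -}

module Defs where

open import Data.Nat using (ℕ; zero; suc; _+_; _∸_; _≤_; _<_; _<ᵇ_; pred)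
open import Data.Nat.Properties using (_≟_; _<?_; _≤?_)
open import Data.Bool using (if_then_else_)
open import Data.List using (List; []; _∷_; map; filter; reverse; length; upTo)
open import Data.List.Relation.Unary.All using (All)
open import Data.List.Relation.Unary.AllPairs using (AllPairs)
open import Data.List.Relation.Unary.Linked using (Linked)
open import Data.List.Membership.Propositional using (_∈_; _∉_)
open import Data.List.Membership.DecPropositional _≟_ using (_∈?_)
open import Data.Product using (_×_; _,_)
open import Data.Sum using (_⊎_)
open import Data.Empty using (⊥)
open import Relation.Nullary using (¬_)
open import Relation.Nullary.Decidable using (¬?; _×-dec_; _⊎-dec_)
open import Relation.Binary.PropositionalEquality using (_≡_)
open import Function.Bundles using (_⇔_)

-- Vectors (i_1,...,i_k) are represented as lists of natural numbers.
-- range1 n = 1 , 2 , ... , n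
range1 : ℕ → List ℕ
range1 n = map suc (upTo n)

V : ℕ → ℕ → List ℕ → Set
V k n I = (length I ≡ k) × Linked _<_ I × All (λ x → 1 ≤ x × x ≤ n) I

-- entry at (0-based) position a; default 0 outside the range (never used for vertices)
at : List ℕ → ℕ → ℕ
at []       _       = 0
at (x ∷ xs) zero    = x
at (x ∷ xs) (suc a) = at xs a

Cross : ℕ → ℕ → ℕ → ℕ → Set
Cross p p' q q' = (p < q × q < p' × p' < q') ⊎ (q < p × p < q' × q' < p')

NC : List ℕ → List ℕ → Set
NC I J = ∀ a b → a < b → b < length I →
         (∀ l → a < l → l < b → at I l ≡ at J l) →
         ¬ Cross (at I a) (at I b) (at J a) (at J b)

Face : (List ℕ → Set) → List (List ℕ) → Set
Face P F = All P F × AllPairs NC F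

ΔNC : ℕ → ℕ → List (List ℕ) → Set
ΔNC k n = Face (V k n)

record SimplicialIso (P Q : List ℕ → Set) (f : List ℕ → List ℕ) : Set where
  field
    g      : List ℕ → List ℕ
    f-vert : ∀ I → P I → Q (f I)
    g-vert : ∀ J → Q J → P (g J)
    gf     : ∀ I → P I → g (f I) ≡ I
    fg     : ∀ J → Q J → f (g J) ≡ J
    faces  : ∀ F → All P F → (Face P F ⇔ Face Q (map f F))

revComp : ℕ → List ℕ → List ℕ
revComp n I = reverse (map (λ i → suc n ∸ i) I)

compl : ℕ → List ℕ → List ℕ
compl n I = filter (λ x → ¬? (x ∈? I)) (range1 n)

diff : List ℕ → List ℕ → List ℕ
diff I J = filter (λ x → ¬? (x ∈? J)) I

symDiff : ℕ → List ℕ → List ℕ → List ℕ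
symDiff n I J = filter (λ x → ((x ∈? I) ×-dec ¬? (x ∈? J)) ⊎-dec (¬? (x ∈? I) ×-dec (x ∈? J))) (range1 n)

-- order-preserving identification of a totally ordered set S with [|S|]:
-- x ↦ 1 + #{ s ∈ S | s < x }
rank : List ℕ → ℕ → ℕ
rank S x = suc (length (filter (_<? x) S))

relabel : List ℕ → List ℕ → List ℕ
relabel S I = map (rank S) I

delete : ℕ → List ℕ → List ℕ
delete b I = map (λ x → if x <ᵇ b then x else pred x) (filter (λ x → ¬? (x ≟ b)) I)

-- (v) the cyclic interval {c, c+1, ..., c+k-1} (entries modulo n, in [n]) as an increasing list:
-- x ∈ [n] belongs to it iff c ≤ x < c + k, or x + n < c + k (wrapped-around part).
cycInt : ℕ → ℕ → ℕ → List ℕ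
cycInt k n c = filter (λ x → ((c ≤? x) ×-dec (x <? c + k)) ⊎-dec (x + n <? c + k)) (range1 n)

MaximalFace : ℕ → ℕ → List (List ℕ) → Set
MaximalFace k n F = ΔNC k n F × (∀ I → V k n I → ΔNC k n (I ∷ F) → I ∈ F)

-- Everything rests on a reformulation of noncrossingness (nc⇔chain).  For
-- vectors I, J of equal length, list the difference pairs (i_l , j_l) at the
-- positions l where i_l ≠ j_l.  Then I and J are noncrossing iff every two
-- CONSECUTIVE difference pairs (p , q), (p' , q') give noncrossing arcs
-- (p < p'), (q < q').  In this form
--  * a map strictly increasing on the entries just relabels the pairs
--    (Monotone.nc-map⇔), and a decreasing one relabels them and reverses
--    their order (Reflection.nc-revComp⇔);
--  * deleting an entry common to I and J preserves the chain condition
--    (chain-remove-common); iterating this gives (iii) (nc⇔restricted);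
--  * a vertex bijection preserving noncrossingness is an isomorphism of the
--    flag complexes (isoFromNC).
module Submission where

open import Defs
open import Data.Nat using (ℕ; zero; suc; _+_; _∸_; _≤_; _<_; z≤n; s≤s; pred; _<ᵇ_)
open import Data.Nat.Properties
open import Data.Nat.Tactic.RingSolver using (solve-∀)
open import Data.Bool using (true; false; if_then_else_)
open import Data.Empty using (⊥; ⊥-elim)
open import Data.Unit using (⊤; tt)
open import Data.Product using (_×_; _,_; _,′_; proj₁; proj₂; ∃)
open import Data.Product.Function.NonDependent.Propositional using (_×-⇔_)
open import Data.Sum.Function.Propositional using (_⊎-⇔_)
open import Data.Sum using (_⊎_; inj₁; inj₂; [_,_]′; map₂)
open import Data.List using (List; []; _∷_; map; filter; reverse; length; upTo; applyUpTo; _++_; _ʳ++_)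
open import Data.List.Properties using (length-applyUpTo; filter-all; filter-accept; filter-reject; length-map; length-upTo; map-∘; map-id-local; unfold-reverse; length-reverse; reverse-map; reverse-involutive; ++-identityʳ)
open import Data.List.Membership.DecPropositional _≟_ using (_∈?_)
open import Data.List.Membership.Propositional using (_∈_; _∉_; find; lose)
open import Data.List.Membership.Propositional.Properties using (∈-filter⁺; ∈-filter⁻; ∈-map⁺; ∈-map⁻; ∈-upTo⁺; ∈-upTo⁻; ∈-applyUpTo⁺; ∈-applyUpTo⁻)
open import Data.List.Relation.Unary.All as All using (All; []; _∷_)
open import Data.List.Relation.Unary.All.Properties using () renaming (map⁺ to All-map⁺)
open import Data.List.Relation.Unary.AllPairs using (AllPairs; []; _∷_)
open import Data.List.Relation.Unary.Any as Any using (here; there; any?)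
open import Data.List.Relation.Unary.Linked as Linked using (Linked; []; [-]; _∷_)
open import Data.List.Relation.Unary.Linked.Properties using (Linked⇒All; applyUpTo⁺₁; applyUpTo⁺₂; filter⁺; map⁺)
open import Function.Base using (flip; _∘_; case_of_)
open import Function.Bundles using (_⇔_; mk⇔; Equivalence)
open import Function.Construct.Symmetry using (⇔-sym)
open import Function.Related.Propositional using (module EquationalReasoning; equivalence; ≡⇒)
open import Relation.Binary.Definitions using (tri<; tri≈; tri>)
open import Relation.Binary.PropositionalEquality using (_≡_; refl; sym; trans; cong; cong₂; subst; subst₂; module ≡-Reasoning)
open import Relation.Nullary using (¬_; yes; no)
open import Relation.Nullary.Decidable using (¬?; _×-dec_; _⊎-dec_; toSum)
open import Relation.Unary using (Decidable)

open Equivalence using (to; from)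
module ⇔-Reasoning = EquationalReasoning {k = equivalence}

Increasing : List ℕ → Set
Increasing = Linked _<_

Bounded : ℕ → ℕ → Set
Bounded n x = 1 ≤ x × x ≤ n

module _ {k n I} (v : V k n I) where
  length-V : length I ≡ k
  length-V = proj₁ v

  increasing-V : Increasing I
  increasing-V = proj₁ (proj₂ v)

  bounded-V : All (Bounded n) I
  bounded-V = proj₂ (proj₂ v)

head<tail : ∀ {x xs} → Increasing (x ∷ xs) → All (x <_) xs
head<tail [-] = []
head<tail (x<y ∷ rest) = Linked⇒All <-trans x<y rest

increasing-cons : ∀ {x xs} → All (x <_) xs → Increasing xs → Increasing (x ∷ xs)
increasing-cons [] [] = [-]
increasing-cons (x<y ∷ _) inc = x<y ∷ inc

head≤member : ∀ {x xs z} → Increasing (x ∷ xs) → z ∈ x ∷ xs → x ≤ z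
head≤member _ (here refl) = ≤-refl
head≤member inc (there z∈xs) = <⇒≤ (All.lookup (head<tail inc) z∈xs)

increasing-ext : ∀ {xs ys} → Increasing xs → Increasing ys →
                 (∀ z → z ∈ xs → z ∈ ys) → (∀ z → z ∈ ys → z ∈ xs) → xs ≡ ys
increasing-ext {[]} {[]} _ _ _ _ = refl
increasing-ext {[]} {y ∷ _} _ _ _ ys⊆xs with () ← ys⊆xs y (here refl)
increasing-ext {x ∷ _} {[]} _ _ xs⊆ys _ with () ← xs⊆ys x (here refl)
increasing-ext {x ∷ xs} {y ∷ ys} incx incy xs⊆ys ys⊆xs =
  cong₂ _∷_ x≡y (increasing-ext (Linked.tail incx) (Linked.tail incy) tail⊆ tail⊇)
  where
  x≡y : x ≡ y
  x≡y = ≤-antisym (head≤member incx (ys⊆xs y (here refl))) (head≤member incy (xs⊆ys x (here refl)))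
  tail⊆ : ∀ z → z ∈ xs → z ∈ ys
  tail⊆ z z∈xs with xs⊆ys z (there z∈xs)
  ... | there z∈ys = z∈ys
  ... | here refl = ⊥-elim (<-irrefl x≡y (All.lookup (head<tail incx) z∈xs))
  tail⊇ : ∀ z → z ∈ ys → z ∈ xs
  tail⊇ z z∈ys with ys⊆xs z (there z∈ys)
  ... | there z∈xs = z∈xs
  ... | here refl = ⊥-elim (<-irrefl (sym x≡y) (All.lookup (head<tail incy) z∈ys))

increasing-filter : ∀ {P : ℕ → Set} (P? : Decidable P) {xs} → Increasing xs → Increasing (filter P? xs)
increasing-filter P? = filter⁺ P? <-trans

module _ {A : Set} {R S : A → A → Set} (h : A → A) (D : A → Set) where

  linked-map : (∀ {x y} → D x → D y → R x y → S (h x) (h y)) →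
               ∀ {xs} → All D xs → Linked R xs → Linked S (map h xs)
  linked-map resp [] [] = []
  linked-map resp (_ ∷ []) [-] = [-]
  linked-map resp (dx ∷ dy ∷ ds) (r ∷ rs) = resp dx dy r ∷ linked-map resp (dy ∷ ds) rs

  linked-unmap : (∀ {x y} → D x → D y → S (h x) (h y) → R x y) →
                 ∀ {xs} → All D xs → Linked S (map h xs) → Linked R xs
  linked-unmap resp [] _ = []
  linked-unmap resp (_ ∷ []) _ = [-]
  linked-unmap resp (dx ∷ dy ∷ ds) (s ∷ ss) = resp dx dy s ∷ linked-unmap resp (dy ∷ ds) ss

  linked-map⇔ : (∀ {x y} → D x → D y → R x y ⇔ S (h x) (h y)) →
                ∀ {xs} → All D xs → Linked R xs ⇔ Linked S (map h xs)
  linked-map⇔ resp ds = mk⇔ (linked-map (λ dx dy → to (resp dx dy)) ds) (linked-unmap (λ dx dy → from (resp dx dy)) ds)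

∈-tail : ∀ {x y : ℕ} {ys} → x ∈ y ∷ ys → ¬ y ≡ x → x ∈ ys
∈-tail (here refl) y≢x = ⊥-elim (y≢x refl)
∈-tail (there x∈ys) _ = x∈ys

remove : ℕ → List ℕ → List ℕ
remove x = filter (λ z → ¬? (z ≟ x))

∈-remove⁻ : ∀ {x z} L → z ∈ remove x L → z ∈ L × ¬ z ≡ x
∈-remove⁻ {x} L = ∈-filter⁻ (λ z → ¬? (z ≟ x))

∈-remove⁺ : ∀ {x z L} → z ∈ L → ¬ z ≡ x → z ∈ remove x L
∈-remove⁺ {x} = ∈-filter⁺ (λ z → ¬? (z ≟ x))

remove-∉ : ∀ x L → x ∉ L → remove x L ≡ L
remove-∉ x L x∉L = filter-all (λ z → ¬? (z ≟ x)) (All.tabulate (λ { z∈L refl → x∉L z∈L }))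

remove-head : ∀ x xs → Increasing (x ∷ xs) → remove x (x ∷ xs) ≡ xs
remove-head x xs inc = trans (filter-reject (λ z → ¬? (z ≟ x)) (λ x≢x → x≢x refl))
  (remove-∉ x xs (λ x∈xs → <-irrefl refl (All.lookup (head<tail inc) x∈xs)))

remove-keep : ∀ x y xs → ¬ y ≡ x → remove x (y ∷ xs) ≡ y ∷ remove x xs
remove-keep x y xs y≢x = filter-accept (λ z → ¬? (z ≟ x)) y≢x

increasing-remove : ∀ x {L} → Increasing L → Increasing (remove x L)
increasing-remove x = increasing-filter (λ z → ¬? (z ≟ x))

length-remove : ∀ x I → Increasing I → x ∈ I → suc (length (remove x I)) ≡ length I
length-remove x (y ∷ I) inc x∈I with y ≟ x
... | yes refl = cong (suc ∘ length) (remove-head y I inc)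
... | no y≢x = cong suc (trans (cong length (remove-keep x y I y≢x))
                               (length-remove x I (Linked.tail inc) (∈-tail x∈I y≢x)))

-- Difference pairs.  A pair (p , q) records entries p of I and q of J at a
-- common position; two pairs are compatible when their arcs (p < p'),
-- (q < q') do not cross.

Pair : Set
Pair = ℕ × ℕ

Compatible : Pair → Pair → Set
Compatible (p , q) (p' , q') = ¬ Cross p p' q q'

Chain : List Pair → Set
Chain = Linked Compatible

diffPairs : List ℕ → List ℕ → List Pair
diffPairs (x ∷ I) (y ∷ J) with x ≟ y
... | yes _ = diffPairs I J
... | no _ = (x , y) ∷ diffPairs I J
diffPairs _ _ = []

diffPairs-≢ : ∀ {x y} I J → ¬ x ≡ y → diffPairs (x ∷ I) (y ∷ J) ≡ (x , y) ∷ diffPairs I J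
diffPairs-≢ {x} {y} I J x≢y with x ≟ y
... | yes x≡y = ⊥-elim (x≢y x≡y)
... | no _ = refl

diffPairs-≡ : ∀ x I J → diffPairs (x ∷ I) (x ∷ J) ≡ diffPairs I J
diffPairs-≡ x I J with x ≟ x
... | yes _ = refl
... | no x≢x = ⊥-elim (x≢x refl)

Leads : Pair → List Pair → Set
Leads P [] = ⊤
Leads P (Q ∷ _) = Compatible P Q

chain-cons⇔ : ∀ {P ds} → Chain (P ∷ ds) ⇔ (Leads P ds × Chain ds)
chain-cons⇔ {ds = []} = mk⇔ (λ _ → tt , []) (λ _ → [-])
chain-cons⇔ {ds = Q ∷ ds} = mk⇔ (λ { (c ∷ ch) → c , ch }) (λ { (c , ch) → c ∷ ch })

no-cross-right : ∀ {x y z} → ¬ Cross x z y z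
no-cross-right (inj₁ (_ , _ , z<z)) = <-irrefl refl z<z
no-cross-right (inj₂ (_ , _ , z<z)) = <-irrefl refl z<z

no-cross-left : ∀ {x p q} → ¬ Cross x p x q
no-cross-left (inj₁ (x<x , _ , _)) = <-irrefl refl x<x
no-cross-left (inj₂ (x<x , _ , _)) = <-irrefl refl x<x

cross-sym : ∀ {p p' q q'} → Cross p p' q q' → Cross q q' p p'
cross-sym (inj₁ c) = inj₂ c
cross-sym (inj₂ c) = inj₁ c

-- The arcs of NC starting at the first position: the arc (x < i_b) does not
-- cross (y < j_b) whenever I and J agree strictly before b.
ArcsFrom : ℕ → ℕ → List ℕ → List ℕ → Set
ArcsFrom x y I J = ∀ b → b < length I → (∀ l → l < b → at I l ≡ at J l) → ¬ Cross x (at I b) y (at J b)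

-- Only the first position where I and J differ matters for ArcsFrom.
arcsFrom⇔leads : ∀ x y I J → length I ≡ length J → ArcsFrom x y I J ⇔ Leads (x , y) (diffPairs I J)
arcsFrom⇔leads x y [] [] _ = mk⇔ (λ _ → tt) (λ _ _ ())
arcsFrom⇔leads x y (p ∷ I) (q ∷ J) eq with p ≟ q
... | yes refl = mk⇔
  (λ arcs → to (arcsFrom⇔leads x y I J (suc-injective eq))
              (λ b b< agree → arcs (suc b) (s≤s b<) λ { zero _ → refl ; (suc l) (s≤s l<b) → agree l l<b }))
  (λ leads → λ { zero _ _ → no-cross-right
               ; (suc b) (s≤s b<) agree → from (arcsFrom⇔leads x y I J (suc-injective eq)) leads b b<
                                            (λ l l<b → agree (suc l) (s≤s l<b)) })
... | no p≢q = mk⇔ (λ arcs → arcs 0 (s≤s z≤n) (λ _ ()))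
  (λ leads → λ { zero _ _ → leads ; (suc b) _ agree → ⊥-elim (p≢q (agree 0 (s≤s z≤n))) })

nc-cons⇔ : ∀ {x y I J} → NC (x ∷ I) (y ∷ J) ⇔ (ArcsFrom x y I J × NC I J)
nc-cons⇔ = mk⇔
  (λ nc → (λ b b< agree → nc 0 (suc b) (s≤s z≤n) (s≤s b<) λ { (suc l) _ (s≤s l<b) → agree l l<b }) ,
          (λ a b a<b b< agree → nc (suc a) (suc b) (s≤s a<b) (s≤s b<)
                                  λ { (suc l) (s≤s a<l) (s≤s l<b) → agree l a<l l<b }))
  λ { (arcs , nc) → λ
    { zero (suc b) _ (s≤s b<) agree → arcs b b< (λ l l<b → agree (suc l) (s≤s z≤n) (s≤s l<b))
    ; (suc a) (suc b) (s≤s a<b) (s≤s b<) agree → nc a b a<b b< (λ l a<l l<b → agree (suc l) (s≤s a<l) (s≤s l<b)) } }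

nc⇔chain : ∀ I J → length I ≡ length J → NC I J ⇔ Chain (diffPairs I J)
nc⇔chain [] [] _ = mk⇔ (λ _ → []) (λ _ _ _ _ ())
nc⇔chain (x ∷ I) (y ∷ J) eq with x ≟ y
... | yes refl = begin
  NC (x ∷ I) (x ∷ J)          ∼⟨ nc-cons⇔ ⟩
  (ArcsFrom x x I J × NC I J) ∼⟨ mk⇔ (λ { (_ , nc) → nc }) (λ nc → diagonal-arcs , nc) ⟩
  NC I J                      ∼⟨ nc⇔chain I J (suc-injective eq) ⟩
  Chain (diffPairs I J)       ∎
  where
  open ⇔-Reasoning
  diagonal-arcs : ArcsFrom x x I J
  diagonal-arcs _ _ _ = no-cross-left
... | no _ = begin
  NC (x ∷ I) (y ∷ J)                                      ∼⟨ nc-cons⇔ ⟩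
  (ArcsFrom x y I J × NC I J)                             ∼⟨ arcsFrom⇔leads x y I J eq' ×-⇔ nc⇔chain I J eq' ⟩
  (Leads (x , y) (diffPairs I J) × Chain (diffPairs I J)) ∼⟨ ⇔-sym chain-cons⇔ ⟩
  Chain ((x , y) ∷ diffPairs I J)                         ∎
  where
  open ⇔-Reasoning
  eq' = suc-injective eq

compatible-below : ∀ {p q p' q'} → q' ≤ p → q' ≤ p' → Compatible (p , q) (p' , q')
compatible-below q'≤p q'≤p' (inj₁ (_ , _ , p'<q')) = <⇒≱ p'<q' q'≤p'
compatible-below q'≤p q'≤p' (inj₂ (_ , p<q' , _)) = <⇒≱ p<q' q'≤p

compatible-lower : ∀ {p q q' Q} → q < p → q' < p → Compatible (p , q) Q → Compatible (p , q') Q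
compatible-lower q<p q'<p compat (inj₁ (p<q' , _)) = <-asym p<q' q'<p
compatible-lower q<p q'<p compat (inj₂ (_ , p<q₂ , q₂<p₂)) = compat (inj₂ (q<p , p<q₂ , q₂<p₂))

compatible-raise : ∀ {P p p' q} → q < p → q < p' → Compatible P (p , q) → Compatible P (p' , q)
compatible-raise q<p q<p' compat (inj₁ (_ , _ , p'<q)) = <-asym p'<q q<p'
compatible-raise q<p q<p' compat (inj₂ (a , b , _)) = compat (inj₂ (a , b , q<p))

chain-change-J : ∀ {p q q' ds} → q < p → q' < p → Chain ((p , q) ∷ ds) ⇔ Chain ((p , q') ∷ ds)
chain-change-J {ds = []} _ _ = mk⇔ (λ _ → [-]) (λ _ → [-])
chain-change-J {ds = _ ∷ _} q<p q'<p =
  mk⇔ (λ { (c ∷ ch) → compatible-lower q<p q'<p c ∷ ch }) (λ { (c ∷ ch) → compatible-lower q'<p q<p c ∷ ch })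

chain-drop-head : ∀ {P Q ds} → Compatible P Q → Chain (P ∷ Q ∷ ds) ⇔ Chain (Q ∷ ds)
chain-drop-head c = mk⇔ Linked.tail (c ∷_)

chain-extend : ∀ {P P' Q Q' ds ds'} → Compatible P Q ⇔ Compatible P' Q' →
               Chain (Q ∷ ds) ⇔ Chain (Q' ∷ ds') → Chain (P ∷ Q ∷ ds) ⇔ Chain (P' ∷ Q' ∷ ds')
chain-extend link rest = mk⇔ (λ { (c ∷ ch) → to link c ∷ to rest ch }) (λ { (c ∷ ch) → from link c ∷ from rest ch })

swap : Pair → Pair
swap (p , q) = (q , p)

diffPairs-swap : ∀ I J → diffPairs J I ≡ map swap (diffPairs I J)
diffPairs-swap (x ∷ I) (y ∷ J) with x ≟ y | y ≟ x
... | yes _ | yes _ = diffPairs-swap I J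
... | no _ | no _ = cong ((y , x) ∷_) (diffPairs-swap I J)
... | yes refl | no y≢x = ⊥-elim (y≢x refl)
... | no x≢y | yes refl = ⊥-elim (x≢y refl)
diffPairs-swap [] [] = refl
diffPairs-swap [] (_ ∷ _) = refl
diffPairs-swap (_ ∷ _) [] = refl

chain-swap : ∀ {ds} → Chain ds → Chain (map swap ds)
chain-swap = Linked.map (λ c → c ∘ cross-sym) ∘ map⁺

chain-swap⇔ : ∀ P I J → Chain (P ∷ diffPairs I J) ⇔ Chain (swap P ∷ diffPairs J I)
chain-swap⇔ P I J = mk⇔
  (λ ch → subst (λ ds → Chain (swap P ∷ ds)) (sym (diffPairs-swap I J)) (chain-swap ch))
  (λ ch → subst (λ ds → Chain (P ∷ ds)) (sym (diffPairs-swap J I)) (chain-swap ch))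

-- The key situation: x is in J and
-- the remaining entries a ∷ A of I all exceed x, while the entries of J
-- before x lie below x.  Deleting x from J shifts those entries of J by one
-- position against I; all the pairs involved have their J-entry below both
-- neighbouring I-entries, so they are mutually compatible and the chain
-- condition is unchanged.  The pair (u , y) in front records the preceding
-- position (y < x ≤ u).
chain-shift : ∀ x a A B u y → Increasing (a ∷ A) → x < a → Increasing B → x ∈ B →
              length (a ∷ A) ≡ length B → y < x → x ≤ u →
              Chain ((u , y) ∷ diffPairs (a ∷ A) B) ⇔ Chain ((a , y) ∷ diffPairs A (remove x B))
chain-shift x a A (b ∷ B) u y incA x<a incB x∈B eq y<x x≤u with b ≟ x
... | yes refl = begin
  Chain ((u , y) ∷ diffPairs (a ∷ A) (x ∷ B)) ≡⟨ cong (λ ds → Chain ((u , y) ∷ ds)) (diffPairs-≢ A B (>⇒≢ x<a)) ⟩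
  Chain ((u , y) ∷ (a , x) ∷ diffPairs A B)   ∼⟨ chain-drop-head (compatible-below x≤u (<⇒≤ x<a)) ⟩
  Chain ((a , x) ∷ diffPairs A B)             ∼⟨ chain-change-J x<a (<-trans y<x x<a) ⟩
  Chain ((a , y) ∷ diffPairs A B)             ≡⟨ cong (λ L → Chain ((a , y) ∷ diffPairs A L)) (sym (remove-head x B incB)) ⟩
  Chain ((a , y) ∷ diffPairs A (remove x (x ∷ B))) ∎
  where open ⇔-Reasoning
chain-shift x a [] (b ∷ []) u y incA x<a incB x∈B eq y<x x≤u | no b≢x with () ← ∈-tail x∈B b≢x
chain-shift x a (a₂ ∷ A) (b ∷ B) u y incA x<a incB x∈B eq y<x x≤u | no b≢x = begin
  Chain ((u , y) ∷ diffPairs (a ∷ a₂ ∷ A) (b ∷ B))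
    ≡⟨ cong (λ ds → Chain ((u , y) ∷ ds)) (diffPairs-≢ (a₂ ∷ A) B (>⇒≢ b<a)) ⟩
  Chain ((u , y) ∷ (a , b) ∷ diffPairs (a₂ ∷ A) B)
    ∼⟨ chain-extend (mk⇔ (λ _ → compatible-below (<⇒≤ b<a) (<⇒≤ b<a₂)) (λ _ → compatible-below (<⇒≤ b<u) (<⇒≤ b<a)))
                    (chain-shift x a₂ A B a b (Linked.tail incA) x<a₂ (Linked.tail incB) x∈B' (suc-injective eq) b<x (<⇒≤ x<a)) ⟩
  Chain ((a , y) ∷ (a₂ , b) ∷ diffPairs A (remove x B))
    ≡⟨ cong (λ ds → Chain ((a , y) ∷ ds)) (sym (diffPairs-≢ A (remove x B) (>⇒≢ b<a₂))) ⟩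
  Chain ((a , y) ∷ diffPairs (a₂ ∷ A) (b ∷ remove x B))
    ≡⟨ cong (λ L → Chain ((a , y) ∷ diffPairs (a₂ ∷ A) L)) (sym (remove-keep x b B b≢x)) ⟩
  Chain ((a , y) ∷ diffPairs (a₂ ∷ A) (remove x (b ∷ B))) ∎
  where
  open ⇔-Reasoning
  x∈B' = ∈-tail x∈B b≢x
  b<x = All.lookup (head<tail incB) x∈B'
  x<a₂ = <-trans x<a (All.lookup (head<tail incA) (here refl))
  b<a = <-trans b<x x<a
  b<a₂ = <-trans b<x x<a₂
  b<u = <-≤-trans b<x x≤u

chain-remove-head : ∀ x I y J P → Increasing (x ∷ I) → Increasing (y ∷ J) → length I ≡ length J →
                    ¬ x ≡ y → x ∈ J →
                    Chain (P ∷ diffPairs (x ∷ I) (y ∷ J)) ⇔ Chain (P ∷ diffPairs (remove x (x ∷ I)) (remove x (y ∷ J)))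
chain-remove-head x (a ∷ A) y J P incI incJ eq x≢y x∈J = begin
  Chain (P ∷ diffPairs (x ∷ a ∷ A) (y ∷ J))
    ≡⟨ cong (λ ds → Chain (P ∷ ds)) (diffPairs-≢ (a ∷ A) J x≢y) ⟩
  Chain (P ∷ (x , y) ∷ diffPairs (a ∷ A) J)
    ∼⟨ chain-extend (mk⇔ (compatible-raise y<x y<a) (compatible-raise y<a y<x))
                    (chain-shift x a A J x y (Linked.tail incI) x<a (Linked.tail incJ) x∈J eq y<x ≤-refl) ⟩
  Chain (P ∷ (a , y) ∷ diffPairs A (remove x J))
    ≡⟨ cong (λ ds → Chain (P ∷ ds)) (sym (diffPairs-≢ A (remove x J) (>⇒≢ y<a))) ⟩
  Chain (P ∷ diffPairs (a ∷ A) (y ∷ remove x J))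
    ≡⟨ cong₂ (λ L M → Chain (P ∷ diffPairs L M)) (sym (remove-head x (a ∷ A) incI)) (sym (remove-keep x y J (x≢y ∘ sym))) ⟩
  Chain (P ∷ diffPairs (remove x (x ∷ a ∷ A)) (remove x (y ∷ J))) ∎
  where
  open ⇔-Reasoning
  y<x = All.lookup (head<tail incJ) x∈J
  x<a = All.lookup (head<tail incI) (here refl)
  y<a = <-trans y<x x<a
chain-remove-head x [] y [] P _ _ _ _ ()

-- Deleting a common entry x from I and J preserves the chain condition.  The
-- pair P in front generalises the statement for the induction.
chain-remove-common : ∀ I J x P → Increasing I → Increasing J → length I ≡ length J → x ∈ I → x ∈ J →
                      Chain (P ∷ diffPairs I J) ⇔ Chain (P ∷ diffPairs (remove x I) (remove x J))
chain-remove-common (x₁ ∷ I) (y₁ ∷ J) x P incI incJ eq x∈I x∈J = case ((x₁ ≟ y₁) ,′ (x₁ ≟ x) ,′ (y₁ ≟ x)) of λ where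
    (yes refl , yes refl , _) → begin
      Chain (P ∷ diffPairs (x ∷ I) (x ∷ J))
        ≡⟨ cong (λ ds → Chain (P ∷ ds)) (diffPairs-≡ x I J) ⟩
      Chain (P ∷ diffPairs I J)
        ≡⟨ cong₂ (λ L M → Chain (P ∷ diffPairs L M)) (sym (remove-head x I incI)) (sym (remove-head x J incJ)) ⟩
      Chain (P ∷ diffPairs (remove x (x ∷ I)) (remove x (x ∷ J))) ∎
    (yes refl , no x₁≢x , _) → begin
      Chain (P ∷ diffPairs (x₁ ∷ I) (x₁ ∷ J))
        ≡⟨ cong (λ ds → Chain (P ∷ ds)) (diffPairs-≡ x₁ I J) ⟩
      Chain (P ∷ diffPairs I J)
        ∼⟨ chain-remove-common I J x P (Linked.tail incI) (Linked.tail incJ) (suc-injective eq)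
                               (∈-tail x∈I x₁≢x) (∈-tail x∈J x₁≢x) ⟩
      Chain (P ∷ diffPairs (remove x I) (remove x J))
        ≡⟨ cong (λ ds → Chain (P ∷ ds)) (sym (diffPairs-≡ x₁ (remove x I) (remove x J))) ⟩
      Chain (P ∷ diffPairs (x₁ ∷ remove x I) (x₁ ∷ remove x J))
        ≡⟨ cong₂ (λ L M → Chain (P ∷ diffPairs L M)) (sym (remove-keep x x₁ I x₁≢x)) (sym (remove-keep x x₁ J x₁≢x)) ⟩
      Chain (P ∷ diffPairs (remove x (x₁ ∷ I)) (remove x (x₁ ∷ J))) ∎
    (no x₁≢y₁ , yes refl , _) →
      chain-remove-head x I y₁ J P incI incJ (suc-injective eq) x₁≢y₁ (∈-tail x∈J (x₁≢y₁ ∘ sym))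
    (no x₁≢y₁ , no x₁≢x , yes refl) → begin
      Chain (P ∷ diffPairs (x₁ ∷ I) (x ∷ J))
        ∼⟨ chain-swap⇔ P (x₁ ∷ I) (x ∷ J) ⟩
      Chain (swap P ∷ diffPairs (x ∷ J) (x₁ ∷ I))
        ∼⟨ chain-remove-head x J x₁ I (swap P) incJ incI (sym (suc-injective eq)) (x₁≢y₁ ∘ sym) (∈-tail x∈I x₁≢x) ⟩
      Chain (swap P ∷ diffPairs (remove x (x ∷ J)) (remove x (x₁ ∷ I)))
        ∼⟨ ⇔-sym (chain-swap⇔ P (remove x (x₁ ∷ I)) (remove x (x ∷ J))) ⟩
      Chain (P ∷ diffPairs (remove x (x₁ ∷ I)) (remove x (x ∷ J))) ∎
    (no x₁≢y₁ , no x₁≢x , no y₁≢x) → begin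
      Chain (P ∷ diffPairs (x₁ ∷ I) (y₁ ∷ J))
        ≡⟨ cong (λ ds → Chain (P ∷ ds)) (diffPairs-≢ I J x₁≢y₁) ⟩
      Chain (P ∷ (x₁ , y₁) ∷ diffPairs I J)
        ∼⟨ chain-extend (mk⇔ (λ c → c) (λ c → c))
             (chain-remove-common I J x (x₁ , y₁) (Linked.tail incI) (Linked.tail incJ) (suc-injective eq)
                                  (∈-tail x∈I x₁≢x) (∈-tail x∈J y₁≢x)) ⟩
      Chain (P ∷ (x₁ , y₁) ∷ diffPairs (remove x I) (remove x J))
        ≡⟨ cong (λ ds → Chain (P ∷ ds)) (sym (diffPairs-≢ (remove x I) (remove x J) x₁≢y₁)) ⟩
      Chain (P ∷ diffPairs (x₁ ∷ remove x I) (y₁ ∷ remove x J))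
        ≡⟨ cong₂ (λ L M → Chain (P ∷ diffPairs L M)) (sym (remove-keep x x₁ I x₁≢x)) (sym (remove-keep x y₁ J y₁≢x)) ⟩
      Chain (P ∷ diffPairs (remove x (x₁ ∷ I)) (remove x (y₁ ∷ J))) ∎
  where open ⇔-Reasoning

-- The pair (0 , 0) is compatible with every pair, so it can be put in front of
-- any chain; this turns chain-remove-common into a statement about bare chains.
chain-origin : ∀ ds → Chain ds ⇔ Chain ((0 , 0) ∷ ds)
chain-origin [] = mk⇔ (λ _ → [-]) (λ _ → [])
chain-origin (_ ∷ _) = mk⇔ (no-cross-left ∷_) Linked.tail

chain-remove-common′ : ∀ I J x → Increasing I → Increasing J → length I ≡ length J → x ∈ I → x ∈ J →
                       Chain (diffPairs I J) ⇔ Chain (diffPairs (remove x I) (remove x J))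
chain-remove-common′ I J x incI incJ eq x∈I x∈J = begin
  Chain (diffPairs I J)                                 ∼⟨ chain-origin _ ⟩
  Chain ((0 , 0) ∷ diffPairs I J)                       ∼⟨ chain-remove-common I J x (0 , 0) incI incJ eq x∈I x∈J ⟩
  Chain ((0 , 0) ∷ diffPairs (remove x I) (remove x J)) ∼⟨ ⇔-sym (chain-origin _) ⟩
  Chain (diffPairs (remove x I) (remove x J))           ∎
  where open ⇔-Reasoning

∈-diff⁻ : ∀ {z} L M → z ∈ diff L M → z ∈ L × z ∉ M
∈-diff⁻ L M = ∈-filter⁻ (λ x → ¬? (x ∈? M))

∈-diff⁺ : ∀ {z L} M → z ∈ L → z ∉ M → z ∈ diff L M
∈-diff⁺ M = ∈-filter⁺ (λ x → ¬? (x ∈? M))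

increasing-diff : ∀ {L} M → Increasing L → Increasing (diff L M)
increasing-diff M = increasing-filter (λ x → ¬? (x ∈? M))

diff-disjoint : ∀ L M → (∀ {z} → z ∈ L → z ∉ M) → diff L M ≡ L
diff-disjoint L M disjoint = filter-all (λ x → ¬? (x ∈? M)) (All.tabulate disjoint)

diff-remove : ∀ x L M → Increasing L → x ∈ M → diff (remove x L) (remove x M) ≡ diff L M
diff-remove x L M incL x∈M = increasing-ext
  (increasing-diff (remove x M) (increasing-remove x incL)) (increasing-diff M incL)
  (λ z z∈ → let z∈L-x , z∉M-x = ∈-diff⁻ (remove x L) (remove x M) z∈ ; z∈L , z≢x = ∈-remove⁻ L z∈L-x
            in ∈-diff⁺ M z∈L (λ z∈M → z∉M-x (∈-remove⁺ z∈M z≢x)))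
  (λ z z∈ → let z∈L , z∉M = ∈-diff⁻ L M z∈
            in ∈-diff⁺ (remove x M) (∈-remove⁺ z∈L (λ { refl → z∉M x∈M })) (z∉M ∘ proj₁ ∘ ∈-remove⁻ M))

chain-diff : ∀ m I J → length I ≡ m → Increasing I → Increasing J → length I ≡ length J →
             (Chain (diffPairs I J) ⇔ Chain (diffPairs (diff I J) (diff J I))) × length (diff I J) ≡ length (diff J I)
chain-diff zero [] [] _ _ _ _ = mk⇔ (λ ch → ch) (λ ch → ch) , refl
chain-diff (suc m) I J lenI incI incJ eq with any? (_∈? J) I
... | no disjoint = ≡⇒ (cong Chain (sym (cong₂ diffPairs diffIJ diffJI))) ,
                    trans (cong length diffIJ) (trans eq (cong length (sym diffJI)))
  where
  diffIJ : diff I J ≡ I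
  diffIJ = diff-disjoint I J (λ z∈I z∈J → disjoint (lose z∈I z∈J))
  diffJI : diff J I ≡ J
  diffJI = diff-disjoint J I (λ z∈J z∈I → disjoint (lose z∈I z∈J))
... | yes common with find common
... | x , x∈I , x∈J = (begin
  Chain (diffPairs I J)                                            ∼⟨ chain-remove-common′ I J x incI incJ eq x∈I x∈J ⟩
  Chain (diffPairs (remove x I) (remove x J))                      ∼⟨ proj₁ smaller ⟩
  Chain (diffPairs (diff (remove x I) (remove x J)) (diff (remove x J) (remove x I)))
    ≡⟨ cong₂ (λ L M → Chain (diffPairs L M)) (diff-remove x I J incI x∈J) (diff-remove x J I incJ x∈I) ⟩
  Chain (diffPairs (diff I J) (diff J I))                          ∎) ,
  trans (cong length (sym (diff-remove x I J incI x∈J))) (trans (proj₂ smaller) (cong length (diff-remove x J I incJ x∈I)))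
  where
  open ⇔-Reasoning
  lengthI-x = length-remove x I incI x∈I
  lengthJ-x = length-remove x J incJ x∈J
  smaller = chain-diff m (remove x I) (remove x J) (suc-injective (trans lengthI-x lenI))
                       (increasing-remove x incI) (increasing-remove x incJ)
                       (suc-injective (trans lengthI-x (trans eq (sym lengthJ-x))))

BothIn : (ℕ → Set) → Pair → Set
BothIn D (p , q) = D p × D q

mapPair : (ℕ → ℕ) → Pair → Pair
mapPair f (p , q) = (f p , f q)

diffPairs-all : ∀ (D : ℕ → Set) I J → All D I → All D J → All (BothIn D) (diffPairs I J)
diffPairs-all D (x ∷ I) (y ∷ J) (dx ∷ dI) (dy ∷ dJ) with x ≟ y
... | yes _ = diffPairs-all D I J dI dJ
... | no _ = (dx , dy) ∷ diffPairs-all D I J dI dJ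
diffPairs-all D [] _ _ _ = []
diffPairs-all D (_ ∷ _) [] _ _ = []

diffPairs-map : ∀ (D : ℕ → Set) (f : ℕ → ℕ) → (∀ {x y} → D x → D y → f x ≡ f y → x ≡ y) →
                ∀ I J → All D I → All D J → diffPairs (map f I) (map f J) ≡ map (mapPair f) (diffPairs I J)
diffPairs-map D f inj (x ∷ I) (y ∷ J) (dx ∷ dI) (dy ∷ dJ) with x ≟ y | f x ≟ f y
... | yes refl | yes _ = diffPairs-map D f inj I J dI dJ
... | yes refl | no fx≢fx = ⊥-elim (fx≢fx refl)
... | no x≢y | yes fx≡fy = ⊥-elim (x≢y (inj dx dy fx≡fy))
... | no _ | no _ = cong ((f x , f y) ∷_) (diffPairs-map D f inj I J dI dJ)
diffPairs-map D f inj [] [] _ _ = refl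
diffPairs-map D f inj [] (_ ∷ _) _ _ = refl
diffPairs-map D f inj (_ ∷ _) [] _ _ = refl

module Monotone (D : ℕ → Set) (f : ℕ → ℕ) (mono : ∀ {x y} → D x → D y → x < y → f x < f y) where

  reflect : ∀ {x y} → D x → D y → f x < f y → x < y
  reflect {x} {y} dx dy fx<fy with <-cmp x y
  ... | tri< x<y _ _ = x<y
  ... | tri≈ _ refl _ = ⊥-elim (<-irrefl refl fx<fy)
  ... | tri> _ _ y<x = ⊥-elim (<-asym fx<fy (mono dy dx y<x))

  injective : ∀ {x y} → D x → D y → f x ≡ f y → x ≡ y
  injective {x} {y} dx dy fx≡fy with <-cmp x y
  ... | tri< x<y _ _ = ⊥-elim (<-irrefl fx≡fy (mono dx dy x<y))
  ... | tri≈ _ x≡y _ = x≡y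
  ... | tri> _ _ y<x = ⊥-elim (<-irrefl (sym fx≡fy) (mono dy dx y<x))

  ⇔-< : ∀ {x y} → D x → D y → x < y ⇔ f x < f y
  ⇔-< dx dy = mk⇔ (mono dx dy) (reflect dx dy)

  compatible⇔ : ∀ {P Q} → BothIn D P → BothIn D Q → Compatible P Q ⇔ Compatible (mapPair f P) (mapPair f Q)
  compatible⇔ (dp , dq) (dp' , dq') = mk⇔ (λ c → c ∘ from cross⇔) (λ c → c ∘ to cross⇔)
    where
    cross⇔ = (⇔-< dp dq ×-⇔ ⇔-< dq dp' ×-⇔ ⇔-< dp' dq') ⊎-⇔ (⇔-< dq dp ×-⇔ ⇔-< dp dq' ×-⇔ ⇔-< dq' dp')

  nc-map⇔ : ∀ I J → All D I → All D J → length I ≡ length J → NC I J ⇔ NC (map f I) (map f J)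
  nc-map⇔ I J dI dJ eq = begin
    NC I J                                          ∼⟨ nc⇔chain I J eq ⟩
    Chain (diffPairs I J)                           ∼⟨ linked-map⇔ (mapPair f) (BothIn D) compatible⇔ (diffPairs-all D I J dI dJ) ⟩
    Chain (map (mapPair f) (diffPairs I J))         ≡⟨ cong Chain (sym (diffPairs-map D f injective I J dI dJ)) ⟩
    Chain (diffPairs (map f I) (map f J))           ∼⟨ ⇔-sym (nc⇔chain (map f I) (map f J) eq′) ⟩
    NC (map f I) (map f J)                          ∎
    where
    open ⇔-Reasoning
    eq′ = trans (length-map f I) (trans eq (sym (length-map f J)))

count : ℕ → List ℕ → ℕ
count x S = length (filter (_<? x) S)

count-∷-< : ∀ {s x} S → s < x → count x (s ∷ S) ≡ suc (count x S)
count-∷-< {s} {x} S s<x = cong length (filter-accept (_<? x) {s} {S} s<x)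

count-∷-≮ : ∀ {s x} S → ¬ s < x → count x (s ∷ S) ≡ count x S
count-∷-≮ {s} {x} S s≮x = cong length (filter-reject (_<? x) {s} {S} s≮x)

count-mono : ∀ S {x y} → x ≤ y → count x S ≤ count y S
count-mono [] _ = z≤n
count-mono (s ∷ S) {x} {y} x≤y with s <? x | s <? y
... | yes s<x | yes s<y = subst₂ _≤_ (sym (count-∷-< S s<x)) (sym (count-∷-< S s<y)) (s≤s (count-mono S x≤y))
... | yes s<x | no s≮y = ⊥-elim (s≮y (<-≤-trans s<x x≤y))
... | no s≮x | yes s<y = subst₂ _≤_ (sym (count-∷-≮ S s≮x)) (sym (count-∷-< S s<y)) (m≤n⇒m≤1+n (count-mono S x≤y))
... | no s≮x | no s≮y = subst₂ _≤_ (sym (count-∷-≮ S s≮x)) (sym (count-∷-≮ S s≮y)) (count-mono S x≤y)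

count-strict : ∀ S {x y} → x ∈ S → x < y → count x S < count y S
count-strict (s ∷ S) {x} {y} x∈S x<y with s <? x | s <? y
... | yes s<x | yes s<y = subst₂ _<_ (sym (count-∷-< S s<x)) (sym (count-∷-< S s<y))
                            (s≤s (count-strict S (∈-tail x∈S (λ s≡x → <-irrefl s≡x s<x)) x<y))
... | yes s<x | no s≮y = ⊥-elim (s≮y (<-trans s<x x<y))
... | no s≮x | yes s<y = subst₂ _<_ (sym (count-∷-≮ S s≮x)) (sym (count-∷-< S s<y)) (s≤s (count-mono S (<⇒≤ x<y)))
... | no s≮x | no s≮y with x∈S
...   | here refl = ⊥-elim (s≮y x<y)
...   | there x∈S′ = subst₂ _<_ (sym (count-∷-≮ S s≮x)) (sym (count-∷-≮ S s≮y)) (count-strict S x∈S′ x<y)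

rank-mono : ∀ S {x y} → x ∈ S → y ∈ S → x < y → rank S x < rank S y
rank-mono S x∈S _ x<y = s≤s (count-strict S x∈S x<y)

∈-range1⁺ : ∀ {n z} → Bounded n z → z ∈ range1 n
∈-range1⁺ {z = suc z} (_ , z<n) = ∈-map⁺ suc (∈-upTo⁺ z<n)

∈-range1⁻ : ∀ {n z} → z ∈ range1 n → Bounded n z
∈-range1⁻ z∈ with _ , z∈upTo , refl ← ∈-map⁻ suc z∈ = s≤s z≤n , ∈-upTo⁻ z∈upTo

increasing-range1 : ∀ n → Increasing (range1 n)
increasing-range1 n = map⁺ (applyUpTo⁺₂ (λ i → i) n (λ i → s≤s (n<1+n i)))

length-range1 : ∀ n → length (range1 n) ≡ n
length-range1 n = trans (length-map suc (upTo n)) (length-upTo n)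

InSymDiff : List ℕ → List ℕ → ℕ → Set
InSymDiff I J x = (x ∈ I × x ∉ J) ⊎ (x ∉ I × x ∈ J)

module _ (n : ℕ) (I J : List ℕ) where
  private
    inSymDiff? = λ x → ((x ∈? I) ×-dec ¬? (x ∈? J)) ⊎-dec (¬? (x ∈? I) ×-dec (x ∈? J))

  ∈-symDiff⁺ : ∀ {z} → Bounded n z → InSymDiff I J z → z ∈ symDiff n I J
  ∈-symDiff⁺ bz = ∈-filter⁺ inSymDiff? (∈-range1⁺ bz)

  ∈-symDiff⁻ : ∀ {z} → z ∈ symDiff n I J → Bounded n z × InSymDiff I J z
  ∈-symDiff⁻ z∈ = let z∈[n] , inS = ∈-filter⁻ inSymDiff? {xs = range1 n} z∈ in ∈-range1⁻ z∈[n] , inS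

  increasing-symDiff : Increasing (symDiff n I J)
  increasing-symDiff = increasing-filter inSymDiff? (increasing-range1 n)

diff-⊆-symDiff : ∀ {k n I} J → V k n I → All (_∈ symDiff n I J) (diff I J)
diff-⊆-symDiff {I = I} J vI = All.tabulate λ z∈ →
  let z∈I , z∉J = ∈-diff⁻ I J z∈ in ∈-symDiff⁺ _ I J (All.lookup (bounded-V vI) z∈I) (inj₁ (z∈I , z∉J))

diff-⊆-symDiff′ : ∀ {k n} I {J} → V k n J → All (_∈ symDiff n I J) (diff J I)
diff-⊆-symDiff′ I {J} vJ = All.tabulate λ z∈ →
  let z∈J , z∉I = ∈-diff⁻ J I z∈ in ∈-symDiff⁺ _ I J (All.lookup (bounded-V vJ) z∈J) (inj₂ (z∉I , z∈J))

length-diff : ∀ {k n I J} → V k n I → V k n J → length (diff I J) ≡ length (diff J I)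
length-diff vI vJ = proj₂ (chain-diff _ _ _ refl (increasing-V vI) (increasing-V vJ) (trans (length-V vI) (sym (length-V vJ))))

nc⇔restricted : ∀ {k n} I J → V k n I → V k n J →
                NC I J ⇔ NC (relabel (symDiff n I J) (diff I J)) (relabel (symDiff n I J) (diff J I))
nc⇔restricted {n = n} I J vI vJ = begin
  NC I J                                 ∼⟨ nc⇔chain I J eq ⟩
  Chain (diffPairs I J)                  ∼⟨ proj₁ (chain-diff _ I J refl (increasing-V vI) (increasing-V vJ) eq) ⟩
  Chain (diffPairs (diff I J) (diff J I)) ∼⟨ ⇔-sym (nc⇔chain (diff I J) (diff J I) (length-diff vI vJ)) ⟩
  NC (diff I J) (diff J I)               ∼⟨ nc-map⇔ (diff I J) (diff J I) (diff-⊆-symDiff J vI) (diff-⊆-symDiff′ I vJ) (length-diff vI vJ) ⟩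
  NC (relabel S (diff I J)) (relabel S (diff J I)) ∎
  where
  open ⇔-Reasoning
  S = symDiff n I J
  eq = trans (length-V vI) (sym (length-V vJ))
  open Monotone (_∈ S) (rank S) (rank-mono S)

allPairs-map⇔ : ∀ {P : List ℕ → Set} {R S : List ℕ → List ℕ → Set} (f : List ℕ → List ℕ) →
                (∀ {I J} → P I → P J → R I J ⇔ S (f I) (f J)) →
                ∀ {F} → All P F → AllPairs R F ⇔ AllPairs S (map f F)
allPairs-map⇔ {P} {R} {S} f resp pF = mk⇔ (forward pF) (backward pF)
  where
  all-forward : ∀ {I F} → P I → All P F → All (R I) F → All (S (f I)) (map f F)
  all-forward pI [] [] = []
  all-forward pI (pJ ∷ pF) (r ∷ rs) = to (resp pI pJ) r ∷ all-forward pI pF rs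
  all-backward : ∀ {I F} → P I → All P F → All (S (f I)) (map f F) → All (R I) F
  all-backward pI [] _ = []
  all-backward pI (pJ ∷ pF) (s ∷ ss) = from (resp pI pJ) s ∷ all-backward pI pF ss
  forward : ∀ {F} → All P F → AllPairs R F → AllPairs S (map f F)
  forward [] [] = []
  forward (pI ∷ pF) (rs ∷ rss) = all-forward pI pF rs ∷ forward pF rss
  backward : ∀ {F} → All P F → AllPairs S (map f F) → AllPairs R F
  backward [] _ = []
  backward (pI ∷ pF) (ss ∷ sss) = all-backward pI pF ss ∷ backward pF sss

isoFromNC : ∀ {P Q : List ℕ → Set} (f g : List ℕ → List ℕ) →
            (∀ I → P I → Q (f I)) → (∀ J → Q J → P (g J)) →
            (∀ I → P I → g (f I) ≡ I) → (∀ J → Q J → f (g J) ≡ J) →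
            (∀ I J → P I → P J → NC I J ⇔ NC (f I) (f J)) → SimplicialIso P Q f
isoFromNC {P} {Q} f g f-vert g-vert gf fg nc⇔ = record
  { g = g ; f-vert = f-vert ; g-vert = g-vert ; gf = gf ; fg = fg
  ; faces = λ F pF → mk⇔ (λ { (_ , nc) → images pF , to (allPairs-map⇔ f (nc⇔ _ _) pF) nc })
                         (λ { (_ , nc) → pF , from (allPairs-map⇔ f (nc⇔ _ _) pF) nc }) }
  where
  images : ∀ {F} → All P F → All Q (map f F)
  images [] = []
  images (pI ∷ pF) = f-vert _ pI ∷ images pF

linked-reverse : ∀ {A : Set} {R : A → A → Set} {l} → Linked R l → Linked (flip R) (reverse l)
linked-reverse {l = []} _ = []
linked-reverse {A} {R} {x ∷ xs} lk = go x xs [] lk [-]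
  where
  -- reverse l = xs ʳ++ [x]; the accumulator is already reversed-linked.
  go : ∀ x xs acc → Linked R (x ∷ xs) → Linked (flip R) (x ∷ acc) → Linked (flip R) (xs ʳ++ (x ∷ acc))
  go x [] acc _ done = done
  go x (y ∷ xs) acc (r ∷ rs) done = go y xs (x ∷ acc) rs (r ∷ done)

linked-reverse⇔ : ∀ {A : Set} {R : A → A → Set} {l} → Linked (flip R) l ⇔ Linked R (reverse l)
linked-reverse⇔ {l = l} = mk⇔ linked-reverse (λ lk → subst (Linked _) (reverse-involutive l) (linked-reverse lk))

all-reverse : ∀ {A : Set} {P : A → Set} {xs} → All P xs → All P (reverse xs)
all-reverse {P = P} = λ ps → go ps []
  where
  go : ∀ {xs acc} → All P xs → All P acc → All P (xs ʳ++ acc)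
  go [] acc = acc
  go (p ∷ ps) acc = go ps (p ∷ acc)

diffPairs-++ : ∀ A₁ A₂ B₁ B₂ → length A₁ ≡ length B₁ →
               diffPairs (A₁ ++ A₂) (B₁ ++ B₂) ≡ diffPairs A₁ B₁ ++ diffPairs A₂ B₂
diffPairs-++ [] A₂ [] B₂ _ = refl
diffPairs-++ (x ∷ A₁) A₂ (y ∷ B₁) B₂ eq with x ≟ y
... | yes _ = diffPairs-++ A₁ A₂ B₁ B₂ (suc-injective eq)
... | no _ = cong ((x , y) ∷_) (diffPairs-++ A₁ A₂ B₁ B₂ (suc-injective eq))

diffPairs-reverse : ∀ A B → length A ≡ length B → diffPairs (reverse A) (reverse B) ≡ reverse (diffPairs A B)
diffPairs-reverse [] [] _ = refl
diffPairs-reverse (x ∷ A) (y ∷ B) eq = begin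
  diffPairs (reverse (x ∷ A)) (reverse (y ∷ B))
    ≡⟨ cong₂ diffPairs (unfold-reverse x A) (unfold-reverse y B) ⟩
  diffPairs (reverse A ++ x ∷ []) (reverse B ++ y ∷ [])
    ≡⟨ diffPairs-++ (reverse A) (x ∷ []) (reverse B) (y ∷ []) (trans (length-reverse A) (trans eq′ (sym (length-reverse B)))) ⟩
  diffPairs (reverse A) (reverse B) ++ diffPairs (x ∷ []) (y ∷ [])
    ≡⟨ cong (_++ diffPairs (x ∷ []) (y ∷ [])) (diffPairs-reverse A B eq′) ⟩
  reverse (diffPairs A B) ++ diffPairs (x ∷ []) (y ∷ [])
    ≡⟨ last-step ⟩
  reverse (diffPairs (x ∷ A) (y ∷ B)) ∎
  where
  open ≡-Reasoning
  eq′ = suc-injective eq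
  last-step : reverse (diffPairs A B) ++ diffPairs (x ∷ []) (y ∷ []) ≡ reverse (diffPairs (x ∷ A) (y ∷ B))
  last-step with x ≟ y
  ... | yes _ = ++-identityʳ (reverse (diffPairs A B))
  ... | no _ = sym (unfold-reverse (x , y) (diffPairs A B))

module Reflection (n : ℕ) where

  mirror : ℕ → ℕ
  mirror x = suc n ∸ x

  mirror-anti : ∀ {x y} → Bounded n x → Bounded n y → x < y → mirror y < mirror x
  mirror-anti _ (_ , y≤n) x<y = ∸-monoʳ-< x<y (m≤n⇒m≤1+n y≤n)

  ⇔-> : ∀ {x y} → Bounded n x → Bounded n y → x < y ⇔ mirror y < mirror x
  ⇔-> {x} {y} bx by = mk⇔ (mirror-anti bx by) reflect
    where
    reflect : mirror y < mirror x → x < y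
    reflect my<mx with <-cmp x y
    ... | tri< x<y _ _ = x<y
    ... | tri≈ _ refl _ = ⊥-elim (<-irrefl refl my<mx)
    ... | tri> _ _ y<x = ⊥-elim (<-asym my<mx (mirror-anti by bx y<x))

  mirror-injective : ∀ {x y} → Bounded n x → Bounded n y → mirror x ≡ mirror y → x ≡ y
  mirror-injective {x} {y} bx by mx≡my with <-cmp x y
  ... | tri< x<y _ _ = ⊥-elim (<-irrefl (sym mx≡my) (mirror-anti bx by x<y))
  ... | tri≈ _ x≡y _ = x≡y
  ... | tri> _ _ y<x = ⊥-elim (<-irrefl mx≡my (mirror-anti by bx y<x))

  mirror-bounded : ∀ {x} → Bounded n x → Bounded n (mirror x)
  mirror-bounded (1≤x , x≤n) = subst (1 ≤_) (sym (+-∸-assoc 1 x≤n)) (s≤s z≤n) , ∸-monoʳ-≤ (suc n) 1≤x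

  mirror-involutive : ∀ {x} → Bounded n x → mirror (mirror x) ≡ x
  mirror-involutive (_ , x≤n) = m∸[m∸n]≡n (m≤n⇒m≤1+n x≤n)

  compatible⇔ : ∀ {P Q} → BothIn (Bounded n) P → BothIn (Bounded n) Q →
                Compatible P Q ⇔ flip Compatible (mapPair mirror P) (mapPair mirror Q)
  compatible⇔ (bp , bq) (bp' , bq') = mk⇔ (λ c → c ∘ from cross⇔) (λ c → c ∘ to cross⇔)
    where
    cross⇔ = mk⇔ (λ { (inj₁ (a , b , c)) → inj₂ (to (⇔-> bp' bq') c , to (⇔-> bq bp') b , to (⇔-> bp bq) a)
                    ; (inj₂ (a , b , c)) → inj₁ (to (⇔-> bq' bp') c , to (⇔-> bp bq') b , to (⇔-> bq bp) a) })
                 (λ { (inj₁ (c , b , a)) → inj₂ (from (⇔-> bq bp) a , from (⇔-> bp bq') b , from (⇔-> bq' bp') c)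
                    ; (inj₂ (c , b , a)) → inj₁ (from (⇔-> bp bq) a , from (⇔-> bq bp') b , from (⇔-> bp' bq') c) })

  V-revComp : ∀ {k I} → V k n I → V k n (revComp n I)
  V-revComp {I = I} vI =
    trans (length-reverse (map mirror I)) (trans (length-map mirror I) (length-V vI)) ,
    linked-reverse (linked-map mirror (Bounded n) mirror-anti (bounded-V vI) (increasing-V vI)) ,
    all-reverse (All-map⁺ (All.map mirror-bounded (bounded-V vI)))

  revComp-involutive : ∀ {k I} → V k n I → revComp n (revComp n I) ≡ I
  revComp-involutive {I = I} vI = begin
    reverse (map mirror (reverse (map mirror I))) ≡⟨ cong reverse (reverse-map mirror (map mirror I)) ⟩
    reverse (reverse (map mirror (map mirror I))) ≡⟨ reverse-involutive _ ⟩
    map mirror (map mirror I)                     ≡⟨ sym (map-∘ I) ⟩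
    map (mirror ∘ mirror) I                       ≡⟨ map-id-local (All.map mirror-involutive (bounded-V vI)) ⟩
    I                                             ∎
    where open ≡-Reasoning

  -- Reflection reverses the list of difference pairs and reflects every arc.
  nc-revComp⇔ : ∀ {k} I J → V k n I → V k n J → NC I J ⇔ NC (revComp n I) (revComp n J)
  nc-revComp⇔ I J vI vJ = begin
    NC I J                                                      ∼⟨ nc⇔chain I J eq ⟩
    Chain (diffPairs I J)                                       ∼⟨ linked-map⇔ (mapPair mirror) (BothIn (Bounded n)) compatible⇔
                                                                               (diffPairs-all (Bounded n) I J (bounded-V vI) (bounded-V vJ)) ⟩
    Linked (flip Compatible) (map (mapPair mirror) (diffPairs I J)) ∼⟨ linked-reverse⇔ ⟩
    Chain (reverse (map (mapPair mirror) (diffPairs I J)))     ≡⟨ cong Chain (sym diffPairs-revComp) ⟩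
    Chain (diffPairs (revComp n I) (revComp n J))               ∼⟨ ⇔-sym (nc⇔chain (revComp n I) (revComp n J) eq-rev) ⟩
    NC (revComp n I) (revComp n J)                              ∎
    where
    open ⇔-Reasoning
    eq = trans (length-V vI) (sym (length-V vJ))
    eq-rev = trans (length-V (V-revComp vI)) (sym (length-V (V-revComp vJ)))
    eq-map = trans (length-map mirror I) (trans eq (sym (length-map mirror J)))
    diffPairs-revComp : diffPairs (revComp n I) (revComp n J) ≡ reverse (map (mapPair mirror) (diffPairs I J))
    diffPairs-revComp = trans (diffPairs-reverse (map mirror I) (map mirror J) eq-map)
      (cong reverse (diffPairs-map (Bounded n) mirror mirror-injective I J (bounded-V vI) (bounded-V vJ)))

  revComp-iso : ∀ k → SimplicialIso (V k n) (V k n) (revComp n)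
  revComp-iso k = isoFromNC (revComp n) (revComp n) (λ _ → V-revComp) (λ _ → V-revComp)
                            (λ _ → revComp-involutive) (λ _ → revComp-involutive) nc-revComp⇔

-- Part (ii): complementation.  Note that compl n I is literally diff (range1 n) I.

∉-compl⇒∈ : ∀ {n I z} → Bounded n z → z ∉ compl n I → z ∈ I
∉-compl⇒∈ {n} {I} {z} bz z∉ with z ∈? I
... | yes z∈I = z∈I
... | no z∉I = ⊥-elim (z∉ (∈-diff⁺ I (∈-range1⁺ bz) z∉I))

∈-compl⁻ : ∀ {n I z} → z ∈ compl n I → Bounded n z × z ∉ I
∈-compl⁻ {n} {I} z∈ = let z∈[n] , z∉I = ∈-diff⁻ (range1 n) I z∈ in ∈-range1⁻ z∈[n] , z∉I

∈-compl⁺ : ∀ {n I z} → Bounded n z → z ∉ I → z ∈ compl n I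
∈-compl⁺ {I = I} bz = ∈-diff⁺ I (∈-range1⁺ bz)

increasing-compl : ∀ n I → Increasing (compl n I)
increasing-compl n I = increasing-diff I (increasing-range1 n)

length-filter-split : ∀ {P : ℕ → Set} (P? : Decidable P) xs →
                      length (filter P? xs) + length (filter (λ x → ¬? (P? x)) xs) ≡ length xs
length-filter-split P? [] = refl
length-filter-split P? (x ∷ xs) with P? x
... | yes _ = cong suc (length-filter-split P? xs)
... | no _ = trans (+-suc _ _) (cong suc (length-filter-split P? xs))

select-range1 : ∀ {k n I} → V k n I → filter (_∈? I) (range1 n) ≡ I
select-range1 {n = n} {I} vI = increasing-ext (increasing-filter (_∈? I) (increasing-range1 n)) (increasing-V vI)
  (λ z z∈ → proj₂ (∈-filter⁻ (_∈? I) {xs = range1 n} z∈))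
  (λ z z∈I → ∈-filter⁺ (_∈? I) (∈-range1⁺ (All.lookup (bounded-V vI) z∈I)) z∈I)

length-compl : ∀ {k n I} → V k n I → k + length (compl n I) ≡ n
length-compl {k} {n} {I} vI = begin
  k + length (compl n I)                                   ≡⟨ cong (_+ length (compl n I)) (sym (length-V vI)) ⟩
  length I + length (compl n I)                            ≡⟨ cong (λ L → length L + length (compl n I)) (sym (select-range1 vI)) ⟩
  length (filter (_∈? I) (range1 n)) + length (compl n I) ≡⟨ length-filter-split (_∈? I) (range1 n) ⟩
  length (range1 n)                                        ≡⟨ length-range1 n ⟩
  n                                                        ∎
  where open ≡-Reasoning

V-compl : ∀ {k n I} → V k n I → V (n ∸ k) n (compl n I)
V-compl {k} {n} {I} vI =
  trans (sym (m+n∸m≡n k _)) (cong (_∸ k) (length-compl vI)) ,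
  increasing-compl n I ,
  All.tabulate (proj₁ ∘ ∈-compl⁻ {n} {I})

V-compl⁻ : ∀ {k n J} → k ≤ n → V (n ∸ k) n J → V k n (compl n J)
V-compl⁻ {k} {n} {J} k≤n vJ = subst (λ m → V m n (compl n J)) (m∸[m∸n]≡n k≤n) (V-compl vJ)

compl-involutive : ∀ {k n I} → V k n I → compl n (compl n I) ≡ I
compl-involutive {n = n} {I} vI = increasing-ext (increasing-compl n (compl n I)) (increasing-V vI)
  (λ z z∈ → let bz , z∉ = ∈-compl⁻ {n} {compl n I} z∈ in ∉-compl⇒∈ bz z∉)
  (λ z z∈I → ∈-compl⁺ (All.lookup (bounded-V vI) z∈I) (λ z∈ → proj₂ (∈-compl⁻ {n} {I} z∈) z∈I))

symDiff-compl : ∀ n I J → symDiff n (compl n I) (compl n J) ≡ symDiff n I J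
symDiff-compl n I J = increasing-ext (increasing-symDiff n (compl n I) (compl n J)) (increasing-symDiff n I J)
  (λ z z∈ → let bz , inS = ∈-symDiff⁻ n (compl n I) (compl n J) z∈ in ∈-symDiff⁺ n I J bz (forward bz inS))
  (λ z z∈ → let bz , inS = ∈-symDiff⁻ n I J z∈ in ∈-symDiff⁺ n (compl n I) (compl n J) bz (backward bz inS))
  where
  ∉I = λ {z} → proj₂ ∘ ∈-compl⁻ {n} {I} {z}
  ∉J = λ {z} → proj₂ ∘ ∈-compl⁻ {n} {J} {z}
  forward : ∀ {z} → Bounded n z → InSymDiff (compl n I) (compl n J) z → InSymDiff I J z
  forward bz (inj₁ (z∈I′ , z∉J′)) = inj₂ (∉I z∈I′ , ∉-compl⇒∈ bz z∉J′)
  forward bz (inj₂ (z∉I′ , z∈J′)) = inj₁ (∉-compl⇒∈ bz z∉I′ , ∉J z∈J′)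
  backward : ∀ {z} → Bounded n z → InSymDiff I J z → InSymDiff (compl n I) (compl n J) z
  backward bz (inj₁ (z∈I , z∉J)) = inj₂ ((λ z∈I′ → ∉I z∈I′ z∈I) , ∈-compl⁺ bz z∉J)
  backward bz (inj₂ (z∉I , z∈J)) = inj₁ (∈-compl⁺ bz z∉I , (λ z∈J′ → ∉J z∈J′ z∈J))

diff-compl : ∀ {k n} I {J} → V k n J → diff (compl n I) (compl n J) ≡ diff J I
diff-compl {n = n} I {J} vJ = increasing-ext (increasing-diff (compl n J) (increasing-compl n I)) (increasing-diff I (increasing-V vJ))
  (λ z z∈ → let z∈I′ , z∉J′ = ∈-diff⁻ (compl n I) (compl n J) z∈ ; bz , z∉I = ∈-compl⁻ {n} {I} z∈I′
            in ∈-diff⁺ I (∉-compl⇒∈ bz z∉J′) z∉I)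
  (λ z z∈ → let z∈J , z∉I = ∈-diff⁻ J I z∈ ; bz = All.lookup (bounded-V vJ) z∈J
            in ∈-diff⁺ (compl n J) (∈-compl⁺ bz z∉I) (λ z∈J′ → proj₂ (∈-compl⁻ {n} {J} z∈J′) z∈J))

nc-sym : ∀ {I J} → length I ≡ length J → NC I J → NC J I
nc-sym eq nc a b a<b b< agree crossing =
  nc a b a<b (subst (b <_) (sym eq) b<) (λ l a<l l<b → sym (agree l a<l l<b)) (cross-sym crossing)

nc-sym⇔ : ∀ I J → length I ≡ length J → NC I J ⇔ NC J I
nc-sym⇔ I J eq = mk⇔ (nc-sym {I} {J} eq) (nc-sym {J} {I} (sym eq))

-- Via (iii): I △ J is unchanged and the roles of I \ J, J \ I are exchanged,
-- which is harmless by symmetry of noncrossingness.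
nc-compl⇔ : ∀ {k n} I J → V k n I → V k n J → NC I J ⇔ NC (compl n I) (compl n J)
nc-compl⇔ {n = n} I J vI vJ = begin
  NC I J                                               ∼⟨ nc⇔restricted I J vI vJ ⟩
  NC (relabel S (diff I J)) (relabel S (diff J I))     ∼⟨ nc-sym⇔ (relabel S (diff I J)) (relabel S (diff J I)) (relabel-length (diff I J) (diff J I) (length-diff vI vJ)) ⟩
  NC (relabel S (diff J I)) (relabel S (diff I J))     ≡⟨ cong₂ (λ T L → NC (relabel T L) (relabel T (diff I J)))
                                                                (sym (symDiff-compl n I J)) (sym (diff-compl I vJ)) ⟩
  NC (relabel S′ (diff (compl n I) (compl n J))) (relabel S′ (diff I J))
                                                       ≡⟨ cong (λ L → NC (relabel S′ (diff (compl n I) (compl n J))) (relabel S′ L))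
                                                               (sym (diff-compl J vI)) ⟩
  NC (relabel S′ (diff (compl n I) (compl n J))) (relabel S′ (diff (compl n J) (compl n I)))
                                                       ∼⟨ ⇔-sym (nc⇔restricted (compl n I) (compl n J) (V-compl vI) (V-compl vJ)) ⟩
  NC (compl n I) (compl n J)                           ∎
  where
  open ⇔-Reasoning
  S = symDiff n I J
  S′ = symDiff n (compl n I) (compl n J)
  relabel-length : ∀ L M → length L ≡ length M → length (relabel S L) ≡ length (relabel S M)
  relabel-length L M eq = trans (length-map (rank S) L) (trans eq (sym (length-map (rank S) M)))

compl-iso : ∀ k n → k ≤ n → SimplicialIso (V k n) (V (n ∸ k) n) (compl n)
compl-iso k n k≤n = isoFromNC (compl n) (compl n) (λ _ → V-compl) (λ _ → V-compl⁻ k≤n)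
                              (λ _ → compl-involutive) (λ _ → compl-involutive) nc-compl⇔

module Deletion (b : ℕ) where

  lower : ℕ → ℕ
  lower x = if x <ᵇ b then x else pred x

  raise : ℕ → ℕ
  raise x = if x <ᵇ b then x else suc x

  lower-< : ∀ {x} → x < b → lower x ≡ x
  lower-< {x} x<b with x <ᵇ b | <⇒<ᵇ x<b
  ... | true | _ = refl

  lower-≮ : ∀ {x} → ¬ x < b → lower x ≡ pred x
  lower-≮ {x} x≮b with x <ᵇ b | <ᵇ⇒< x b
  ... | true | x<b = ⊥-elim (x≮b (x<b tt))
  ... | false | _ = refl

  raise-< : ∀ {x} → x < b → raise x ≡ x
  raise-< {x} x<b with x <ᵇ b | <⇒<ᵇ x<b
  ... | true | _ = refl

  raise-≮ : ∀ {x} → ¬ x < b → raise x ≡ suc x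
  raise-≮ {x} x≮b with x <ᵇ b | <ᵇ⇒< x b
  ... | true | x<b = ⊥-elim (x≮b (x<b tt))
  ... | false | _ = refl

  lower-mono : ∀ {x y} → ¬ x ≡ b → ¬ y ≡ b → x < y → lower x < lower y
  lower-mono {x} {y} x≢b y≢b x<y with <-cmp x b | <-cmp y b
  ... | tri≈ _ x≡b _ | _ = ⊥-elim (x≢b x≡b)
  ... | _ | tri≈ _ y≡b _ = ⊥-elim (y≢b y≡b)
  ... | tri< x<b _ _ | tri< y<b _ _ = subst₂ _<_ (sym (lower-< x<b)) (sym (lower-< y<b)) x<y
  ... | tri< x<b _ _ | tri> _ _ b<y = subst₂ _<_ (sym (lower-< x<b)) (sym (lower-≮ (<-asym b<y))) (<-≤-trans x<b (<⇒≤pred b<y))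
  ... | tri> _ _ b<x | tri< y<b _ _ = ⊥-elim (<-asym (<-trans b<x x<y) y<b)
  ... | tri> _ _ b<x | tri> _ _ b<y = subst₂ _<_ (sym (lower-≮ (<-asym b<x))) (sym (lower-≮ (<-asym b<y))) (pred-< b<x x<y)
    where
    pred-< : ∀ {x y} → b < x → x < y → pred x < pred y
    pred-< {suc _} {suc _} _ (s≤s x<y) = x<y

  raise-mono : ∀ {x y} → x < y → raise x < raise y
  raise-mono {x} {y} x<y with x <? b | y <? b
  ... | yes x<b | yes y<b = subst₂ _<_ (sym (raise-< x<b)) (sym (raise-< y<b)) x<y
  ... | yes x<b | no y≮b = subst₂ _<_ (sym (raise-< x<b)) (sym (raise-≮ y≮b)) (m<n⇒m<1+n x<y)
  ... | no x≮b | yes y<b = ⊥-elim (x≮b (<-trans x<y y<b))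
  ... | no x≮b | no y≮b = subst₂ _<_ (sym (raise-≮ x≮b)) (sym (raise-≮ y≮b)) (s≤s x<y)

  raise-lower : ∀ {x} → ¬ x ≡ b → raise (lower x) ≡ x
  raise-lower {x} x≢b with <-cmp x b
  ... | tri< x<b _ _ = trans (cong raise (lower-< x<b)) (raise-< x<b)
  ... | tri≈ _ x≡b _ = ⊥-elim (x≢b x≡b)
  ... | tri> _ _ b<x@(s≤s b≤x-1) =
    trans (cong raise (lower-≮ (<-asym b<x))) (trans (raise-≮ (≤⇒≯ b≤x-1)) (suc-pred x))

  lower-raise : ∀ x → lower (raise x) ≡ x
  lower-raise x with x <? b
  ... | yes x<b = trans (cong lower (raise-< x<b)) (lower-< x<b)
  ... | no x≮b = trans (cong lower (raise-≮ x≮b)) (lower-≮ (x≮b ∘ <-trans (n<1+n x)))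

  raise≢ : ∀ x → ¬ raise x ≡ b
  raise≢ x rx≡b with x <? b
  ... | yes x<b = <-irrefl (trans (sym (raise-< x<b)) rx≡b) x<b
  ... | no x≮b = x≮b (subst (x <_) (trans (sym (raise-≮ x≮b)) rx≡b) (n<1+n x))

  insert : List ℕ → List ℕ
  insert [] = b ∷ []
  insert (x ∷ xs) with x <? b
  ... | yes _ = x ∷ insert xs
  ... | no _ = b ∷ x ∷ xs

  length-insert : ∀ xs → length (insert xs) ≡ suc (length xs)
  length-insert [] = refl
  length-insert (x ∷ xs) with x <? b
  ... | yes _ = cong suc (length-insert xs)
  ... | no _ = refl

  ∈-insert⁻ : ∀ {z} xs → z ∈ insert xs → z ≡ b ⊎ z ∈ xs
  ∈-insert⁻ [] (here z≡b) = inj₁ z≡b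
  ∈-insert⁻ (x ∷ xs) z∈ with x <? b | z∈
  ... | yes _ | here z≡x = inj₂ (here z≡x)
  ... | yes _ | there z∈′ = map₂ there (∈-insert⁻ xs z∈′)
  ... | no _ | here z≡b = inj₁ z≡b
  ... | no _ | there z∈xs = inj₂ z∈xs

  ∈-insert⁺ : ∀ {z} xs → z ≡ b ⊎ z ∈ xs → z ∈ insert xs
  ∈-insert⁺ [] (inj₁ z≡b) = here z≡b
  ∈-insert⁺ (x ∷ xs) z∈ with x <? b | z∈
  ... | yes _ | inj₁ z≡b = there (∈-insert⁺ xs (inj₁ z≡b))
  ... | yes _ | inj₂ (here z≡x) = here z≡x
  ... | yes _ | inj₂ (there z∈xs) = there (∈-insert⁺ xs (inj₂ z∈xs))
  ... | no _ | inj₁ z≡b = here z≡b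
  ... | no _ | inj₂ z∈xs = there z∈xs

  increasing-insert : ∀ xs → Increasing xs → b ∉ xs → Increasing (insert xs)
  increasing-insert [] _ _ = [-]
  increasing-insert (x ∷ xs) inc b∉ with x <? b
  ... | yes x<b = increasing-cons (All.tabulate x<) (increasing-insert xs (Linked.tail inc) (b∉ ∘ there))
    where
    x< : ∀ {z} → z ∈ insert xs → x < z
    x< z∈ with ∈-insert⁻ xs z∈
    ... | inj₁ refl = x<b
    ... | inj₂ z∈xs = All.lookup (head<tail inc) z∈xs
  ... | no x≮b = b<x ∷ inc
    where
    b<x : b < x
    b<x with <-cmp b x
    ... | tri< b<x _ _ = b<x
    ... | tri≈ _ refl _ = ⊥-elim (b∉ (here refl))
    ... | tri> _ _ x<b = ⊥-elim (x≮b x<b)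

  module _ {m : ℕ} (1≤b : 1 ≤ b) (b≤1+m : b ≤ suc m) where

    lower-bounded : ∀ {x} → Bounded (suc m) x → ¬ x ≡ b → Bounded m (lower x)
    lower-bounded {x} (1≤x , x≤1+m) x≢b with <-cmp x b
    ... | tri< x<b _ _ = subst (Bounded m) (sym (lower-< x<b)) (1≤x , ≤-pred (<-≤-trans x<b b≤1+m))
    ... | tri≈ _ x≡b _ = ⊥-elim (x≢b x≡b)
    ... | tri> _ _ b<x = subst (Bounded m) (sym (lower-≮ (<-asym b<x))) (1≤pred (<-≤-trans (s≤s 1≤b) b<x) , pred-mono-≤ x≤1+m)
      where
      1≤pred : ∀ {x} → 2 ≤ x → 1 ≤ pred x
      1≤pred (s≤s (s≤s _)) = s≤s z≤n

    raise-bounded : ∀ {x} → Bounded m x → Bounded (suc m) (raise x)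
    raise-bounded {x} (1≤x , x≤m) with x <? b
    ... | yes x<b = subst (Bounded (suc m)) (sym (raise-< x<b)) (1≤x , m≤n⇒m≤1+n x≤m)
    ... | no x≮b = subst (Bounded (suc m)) (sym (raise-≮ x≮b)) (s≤s z≤n , s≤s x≤m)

    V-delete : ∀ {k L} → length L ≡ k → Increasing L → All (Bounded (suc m)) L → All (λ x → ¬ x ≡ b) L →
               V k m (map lower L)
    V-delete {L = L} len inc bnd ≢b =
      trans (length-map lower L) len ,
      linked-map lower (λ x → ¬ x ≡ b) lower-mono ≢b inc ,
      All-map⁺ (All.zipWith (λ (bx , x≢b) → lower-bounded bx x≢b) (bnd , ≢b))

    V-raise : ∀ {k J} → V k m J → V k (suc m) (map raise J)
    V-raise {J = J} vJ =
      trans (length-map raise J) (length-V vJ) ,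
      linked-map raise (λ _ → ⊤) (λ _ _ → raise-mono) (All.tabulate (λ _ → tt)) (increasing-V vJ) ,
      All-map⁺ (All.map raise-bounded (bounded-V vJ))

    BothOrNeither : List ℕ → List ℕ → Set
    BothOrNeither I J = (b ∈ I × b ∈ J) ⊎ (b ∉ I × b ∉ J)

    -- Deletion preserves and reflects noncrossingness of vertices of the same
    -- size: removing the common entry b is chain-remove-common, and lower is
    -- strictly increasing away from b.
    nc-delete⇔ : ∀ I J → Increasing I → Increasing J → length I ≡ length J →
                 BothOrNeither I J → NC I J ⇔ NC (delete b I) (delete b J)
    nc-delete⇔ I J incI incJ eq common = begin
      NC I J                                  ∼⟨ nc-remove⇔ common ⟩
      NC (remove b I) (remove b J)            ∼⟨ nc-map⇔ (remove b I) (remove b J) (all-≢ I) (all-≢ J) (eq-remove common) ⟩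
      NC (delete b I) (delete b J)            ∎
      where
      open ⇔-Reasoning
      open Monotone (λ x → ¬ x ≡ b) lower lower-mono
      all-≢ : ∀ L → All (λ x → ¬ x ≡ b) (remove b L)
      all-≢ L = All.tabulate (proj₂ ∘ ∈-remove⁻ L)
      eq-remove : BothOrNeither I J → length (remove b I) ≡ length (remove b J)
      eq-remove (inj₁ (b∈I , b∈J)) = suc-injective (trans (length-remove b I incI b∈I) (trans eq (sym (length-remove b J incJ b∈J))))
      eq-remove (inj₂ (b∉I , b∉J)) = trans (cong length (remove-∉ b I b∉I)) (trans eq (cong length (sym (remove-∉ b J b∉J))))
      nc-remove⇔ : BothOrNeither I J → NC I J ⇔ NC (remove b I) (remove b J)
      nc-remove⇔ (inj₁ (b∈I , b∈J)) = begin
        NC I J                                       ∼⟨ nc⇔chain I J eq ⟩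
        Chain (diffPairs I J)                        ∼⟨ chain-remove-common′ I J b incI incJ eq b∈I b∈J ⟩
        Chain (diffPairs (remove b I) (remove b J))  ∼⟨ ⇔-sym (nc⇔chain (remove b I) (remove b J) (eq-remove (inj₁ (b∈I , b∈J)))) ⟩
        NC (remove b I) (remove b J)                 ∎
      nc-remove⇔ (inj₂ (b∉I , b∉J)) = ≡⇒ (sym (cong₂ NC (remove-∉ b I b∉I) (remove-∉ b J b∉J)))

    b∉raise : ∀ J → b ∉ map raise J
    b∉raise J b∈ with _ , _ , b≡rx ← ∈-map⁻ raise b∈ = raise≢ _ (sym b≡rx)

    lower∘raise : ∀ J → map lower (map raise J) ≡ J
    lower∘raise J = trans (sym (map-∘ J)) (map-id-local (All.tabulate (λ {x} _ → lower-raise x)))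

    raise∘lower : ∀ L → All (λ x → ¬ x ≡ b) L → map raise (map lower L) ≡ L
    raise∘lower L ≢b = trans (sym (map-∘ L)) (map-id-local (All.map raise-lower ≢b))

    delete-iso∈ : ∀ k → SimplicialIso (λ I → V (suc k) (suc m) I × b ∈ I) (V k m) (delete b)
    delete-iso∈ k = isoFromNC (delete b) (insert ∘ map raise) f-vert g-vert gf fg
      (λ I J (vI , b∈I) (vJ , b∈J) → nc-delete⇔ I J (increasing-V vI) (increasing-V vJ)
                                        (trans (length-V vI) (sym (length-V vJ))) (inj₁ (b∈I , b∈J)))
      where
      f-vert : ∀ I → V (suc k) (suc m) I × b ∈ I → V k m (delete b I)
      f-vert I (vI , b∈I) =
        V-delete (suc-injective (trans (length-remove b I (increasing-V vI) b∈I) (length-V vI)))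
                 (increasing-remove b (increasing-V vI))
                 (All.tabulate (All.lookup (bounded-V vI) ∘ proj₁ ∘ ∈-remove⁻ I))
                 (All.tabulate (proj₂ ∘ ∈-remove⁻ I))
      g-vert : ∀ J → V k m J → V (suc k) (suc m) (insert (map raise J)) × b ∈ insert (map raise J)
      g-vert J vJ =
        (trans (length-insert (map raise J)) (cong suc (length-V vJ′)) ,
         increasing-insert (map raise J) (increasing-V vJ′) (b∉raise J) ,
         All.tabulate (λ z∈ → bounded (∈-insert⁻ (map raise J) z∈))) ,
        ∈-insert⁺ (map raise J) (inj₁ refl)
        where
        vJ′ = V-raise vJ
        bounded : ∀ {z} → z ≡ b ⊎ z ∈ map raise J → Bounded (suc m) z
        bounded (inj₁ refl) = 1≤b , b≤1+m
        bounded (inj₂ z∈) = All.lookup (bounded-V vJ′) z∈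
      gf : ∀ I → V (suc k) (suc m) I × b ∈ I → insert (map raise (delete b I)) ≡ I
      gf I (vI , b∈I) = trans (cong insert (raise∘lower (remove b I) (All.tabulate (proj₂ ∘ ∈-remove⁻ I))))
        (increasing-ext (increasing-insert (remove b I) (increasing-remove b (increasing-V vI)) (λ b∈ → proj₂ (∈-remove⁻ I b∈) refl))
                        (increasing-V vI)
          (λ z z∈ → [ (λ { refl → b∈I }) , proj₁ ∘ ∈-remove⁻ I ]′ (∈-insert⁻ (remove b I) z∈))
          (λ z z∈I → ∈-insert⁺ (remove b I) (map₂ (∈-remove⁺ z∈I) (toSum (z ≟ b)))))
      fg : ∀ J → V k m J → delete b (insert (map raise J)) ≡ J
      fg J vJ = trans (cong (map lower) remove-insert) (lower∘raise J)
        where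
        L = map raise J
        remove-insert : remove b (insert L) ≡ L
        remove-insert = increasing-ext
          (increasing-remove b (increasing-insert L (increasing-V (V-raise vJ)) (b∉raise J))) (increasing-V (V-raise vJ))
          (λ z z∈ → let z∈ins , z≢b = ∈-remove⁻ (insert L) z∈ in [ ⊥-elim ∘ z≢b , (λ z∈L → z∈L) ]′ (∈-insert⁻ L z∈ins))
          (λ z z∈L → ∈-remove⁺ (∈-insert⁺ L (inj₂ z∈L)) (λ { refl → b∉raise J z∈L }))

    delete-iso∉ : ∀ k → SimplicialIso (λ I → V k (suc m) I × b ∉ I) (V k m) (delete b)
    delete-iso∉ k = isoFromNC (delete b) (map raise) f-vert g-vert gf fg
      (λ I J (vI , b∉I) (vJ , b∉J) → nc-delete⇔ I J (increasing-V vI) (increasing-V vJ)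
                                        (trans (length-V vI) (sym (length-V vJ))) (inj₂ (b∉I , b∉J)))
      where
      ≢b : ∀ {I} → b ∉ I → All (λ x → ¬ x ≡ b) I
      ≢b b∉I = All.tabulate (λ { z∈I refl → b∉I z∈I })
      f-vert : ∀ I → V k (suc m) I × b ∉ I → V k m (delete b I)
      f-vert I (vI , b∉I) = subst (V k m ∘ map lower) (sym (remove-∉ b I b∉I))
                                  (V-delete (length-V vI) (increasing-V vI) (bounded-V vI) (≢b b∉I))
      g-vert : ∀ J → V k m J → V k (suc m) (map raise J) × b ∉ map raise J
      g-vert J vJ = V-raise vJ , b∉raise J
      gf : ∀ I → V k (suc m) I × b ∉ I → map raise (delete b I) ≡ I
      gf I (vI , b∉I) = trans (cong (map raise ∘ map lower) (remove-∉ b I b∉I)) (raise∘lower I (≢b b∉I))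
      fg : ∀ J → V k m J → delete b (map raise J) ≡ J
      fg J vJ = trans (cong (map lower) (remove-∉ b (map raise J) (b∉raise J))) (lower∘raise J)

lower-bound : ∀ a I l → All (a ≤_) I → Increasing I → l < length I → a + l ≤ at I l
lower-bound a (x ∷ I) zero (a≤x ∷ _) _ _ = subst (_≤ x) (sym (+-identityʳ a)) a≤x
lower-bound a (x ∷ I) (suc l) (a≤x ∷ _) inc (s≤s l<) = begin
  a + suc l     ≡⟨ +-suc a l ⟩
  suc a + l     ≤⟨ +-monoˡ-≤ l (s≤s a≤x) ⟩
  suc x + l     ≤⟨ lower-bound (suc x) I l (head<tail inc) (Linked.tail inc) l< ⟩
  at I l        ∎
  where open ≤-Reasoning

upper-bound-head : ∀ {n} x I → Increasing (x ∷ I) → All (_≤ n) I → x ≤ n → x + length I ≤ n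
upper-bound-head x [] _ _ x≤n = subst (_≤ _) (sym (+-identityʳ x)) x≤n
upper-bound-head {n} x (y ∷ I) inc (y≤n ∷ ≤n) x≤n = begin
  x + suc (length I)  ≡⟨ +-suc x (length I) ⟩
  suc x + length I    ≤⟨ +-monoˡ-≤ (length I) (Linked.head inc) ⟩
  y + length I        ≤⟨ upper-bound-head y I (Linked.tail inc) ≤n y≤n ⟩
  n                   ∎
  where open ≤-Reasoning

upper-bound : ∀ {n} I l → Increasing I → All (_≤ n) I → l < length I → at I l + (length I ∸ suc l) ≤ n
upper-bound (x ∷ I) zero inc (x≤n ∷ ≤n) _ = upper-bound-head x I inc ≤n x≤n
upper-bound (x ∷ I) (suc l) inc (_ ∷ ≤n) (s≤s l<) = upper-bound I l (Linked.tail inc) ≤n l<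

module _ {k n I} (vI : V k n I) where
  entry-≥ : ∀ l → l < k → suc l ≤ at I l
  entry-≥ l l<k = lower-bound 1 I l (All.map proj₁ (bounded-V vI)) (increasing-V vI) (subst (l <_) (sym (length-V vI)) l<k)

  entry-≤ : ∀ l → l < k → at I l + (k ∸ suc l) ≤ n
  entry-≤ l l<k = subst (λ k → at I l + (k ∸ suc l) ≤ n) (length-V vI)
    (upper-bound I l (increasing-V vI) (All.map proj₂ (bounded-V vI)) (subst (l <_) (sym (length-V vI)) l<k))

  entry-< : ∀ l → suc l < k → at I l < at I (suc l)
  entry-< l sl<k = go I l (increasing-V vI) (subst (suc l <_) (sym (length-V vI)) sl<k)
    where
    go : ∀ I l → Increasing I → suc l < length I → at I l < at I (suc l)
    go (x ∷ y ∷ I) zero (x<y ∷ _) _ = x<y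
    go (x ∷ y ∷ I) (suc l) (_ ∷ inc) (s≤s l<) = go (y ∷ I) l inc l<
    go (_ ∷ []) _ [-] (s≤s ())

-- A criterion for a vector C to cross no vertex: at each step C either
-- increases by exactly one, or the step splits C into a prefix that is
-- entrywise minimal and a suffix that is entrywise maximal among all
-- vertices.  (Cyclic intervals have this form: the only non-unit step is
-- the wrap-around from 1, ..., r to c, ..., n.)
ExtremalStep : ℕ → ℕ → List ℕ → ℕ → Set
ExtremalStep k n C l = (∀ m → m ≤ l → ∀ I → V k n I → at C m ≤ at I m) ×
                       (∀ m → l < m → m < k → ∀ I → V k n I → at I m ≤ at C m)

UnitOrExtremal : ℕ → ℕ → List ℕ → Set
UnitOrExtremal k n C = ∀ l → suc l < k → (at C (suc l) ≡ suc (at C l)) ⊎ ExtremalStep k n C l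

squeeze : ∀ {p q} → p < suc q → q < p → ⊥
squeeze p<1+q q<p = <⇒≱ q<p (≤-pred p<1+q)

module _ {k n} (C : List ℕ) (lenC : length C ≡ k) (steps : UnitOrExtremal k n C) {I} (vI : V k n I) where

  -- c_a < i_a < c_b < i_b is impossible: look at the step after a.
  no-cross-forward : ∀ {a b} → a < b → b < k → (∀ l → a < l → l < b → at C l ≡ at I l) →
                     at C a < at I a → at I a < at C b → at C b < at I b → ⊥
  no-cross-forward {a} {b} a<b b<k agree ca<ia ia<cb cb<ib with steps a (≤-<-trans a<b b<k)
  ... | inj₂ (_ , suffix-max) = <⇒≱ cb<ib (suffix-max b a<b b<k I vI)
  ... | inj₁ unit with m≤n⇒m<n∨m≡n a<b
  ...   | inj₂ refl = squeeze (subst (at I a <_) unit ia<cb) ca<ia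
  ...   | inj₁ a+1<b = squeeze (subst (at I a <_) (trans (sym (agree (suc a) ≤-refl a+1<b)) unit)
                                         (entry-< vI a (<-trans a+1<b b<k))) ca<ia

  -- i_a < c_a < i_b < c_b is impossible: look at the step before b.
  no-cross-backward : ∀ {a b} → a < suc b → suc b < k → (∀ l → a < l → l < suc b → at C l ≡ at I l) →
                      at I a < at C a → at C a < at I (suc b) → at I (suc b) < at C (suc b) → ⊥
  no-cross-backward {a} {b} a<b b<k agree ia<ca ca<ib ib<cb with steps b b<k
  ... | inj₂ (prefix-min , _) = <⇒≱ ia<ca (prefix-min a (≤-pred a<b) I vI)
  ... | inj₁ unit with m≤n⇒m<n∨m≡n (≤-pred a<b)
  ...   | inj₂ refl = squeeze (subst (at I (suc a) <_) unit ib<cb) ca<ib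
  ...   | inj₁ a<b′ = squeeze (subst (at I (suc b) <_) unit ib<cb)
                              (subst (_< at I (suc b)) (sym (agree b a<b′ ≤-refl)) (entry-< vI b b<k))

  noncrossing-extremal : NC C I
  noncrossing-extremal a b a<b b<len agree (inj₁ (ca<ia , ia<cb , cb<ib)) =
    no-cross-forward a<b (subst (b <_) lenC b<len) agree ca<ia ia<cb cb<ib
  noncrossing-extremal a (suc b) a<b b<len agree (inj₂ (ia<ca , ca<ib , ib<cb)) =
    no-cross-backward a<b (subst (suc b <_) lenC b<len) agree ia<ca ca<ib ib<cb

at-applyUpTo : ∀ h k l → l < k → at (applyUpTo h k) l ≡ h l
at-applyUpTo h (suc k) zero _ = refl
at-applyUpTo h (suc k) (suc l) (s≤s l<k) = at-applyUpTo (h ∘ suc) k l l<k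

-- The cyclic interval {c, ..., c + k - 1} (mod n) listed increasingly: with
-- r = c + k - (n + 1) wrapped-around elements it is 1, ..., r, c + 0, ..., c + (k - 1 - r).
module CyclicInterval (k n c : ℕ) (1≤c : 1 ≤ c) (c≤n : c ≤ n) (k<n : k < n) where

  r : ℕ
  r = (c + k) ∸ suc n

  entry : ℕ → ℕ
  entry l with l <? r
  ... | yes _ = suc l
  ... | no _ = c + (l ∸ r)

  entry-wrapped : ∀ {l} → l < r → entry l ≡ suc l
  entry-wrapped {l} l<r with l <? r
  ... | yes _ = refl
  ... | no l≮r = ⊥-elim (l≮r l<r)

  entry-unwrapped : ∀ {l} → ¬ l < r → entry l ≡ c + (l ∸ r)
  entry-unwrapped {l} l≮r with l <? r
  ... | yes l<r = ⊥-elim (l≮r l<r)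
  ... | no _ = refl

  wraps : (r ≡ 0 × c + k ≤ suc n) ⊎ (0 < r × c + k ≡ suc n + r)
  wraps with c + k ≤? suc n
  ... | yes c+k≤1+n = inj₁ (m≤n⇒m∸n≡0 c+k≤1+n , c+k≤1+n)
  ... | no c+k≰1+n = inj₂ (m<n⇒0<n∸m (≰⇒> c+k≰1+n) , sym (m+[n∸m]≡n (<⇒≤ (≰⇒> c+k≰1+n))))

  wrap-equation : 0 < r → c + k ≡ suc n + r
  wrap-equation 0<r with wraps
  ... | inj₁ (r≡0 , _) = ⊥-elim (<-irrefl (sym r≡0) 0<r)
  ... | inj₂ (_ , eq) = eq

  InInterval : ℕ → Set
  InInterval x = (c ≤ x × x < c + k) ⊎ x + n < c + k

  private
    shift₁ : ∀ a b → suc a + b ≡ suc b + a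
    shift₁ = solve-∀
    shift₂ : ∀ c r d → c + (r + d) ≡ r + (c + d)
    shift₂ = solve-∀
    shift₃ : ∀ c r d → c + (r + d) ≡ (c + d) + r
    shift₃ = solve-∀
    shift₄ : ∀ c r d e → c + (suc (r + d) + e) ≡ suc (c + d + e) + r
    shift₄ = solve-∀

  interval⊆entries : ∀ x → Bounded n x → InInterval x → ∃ λ l → l < k × x ≡ entry l
  interval⊆entries (suc l) (1≤x , x≤n) (inj₂ x+n<c+k) = l , <-≤-trans l<r r≤k , sym (entry-wrapped l<r)
    where
    wrap : c + k ≡ suc n + r
    wrap with wraps
    ... | inj₁ (_ , c+k≤1+n) = ⊥-elim (<-irrefl refl (<-≤-trans (≤-<-trans (+-monoˡ-≤ n 1≤x) x+n<c+k) c+k≤1+n))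
    ... | inj₂ (_ , eq) = eq
    l<r : l < r
    l<r = +-cancelˡ-< (suc n) l r (subst₂ _<_ (shift₁ l n) wrap x+n<c+k)
    r≤k : r ≤ k
    r≤k = +-cancelˡ-≤ (suc n) r k (subst (_≤ suc n + k) wrap (+-monoˡ-≤ k (m≤n⇒m≤1+n c≤n)))
  interval⊆entries x (1≤x , x≤n) (inj₁ (c≤x , x<c+k)) with wraps
  ... | inj₁ (r≡0 , _) = d , d<k , sym (trans (entry-unwrapped d≮r) (trans (cong (λ t → c + (d ∸ t)) r≡0) c+d≡x))
    where
    d = x ∸ c
    c+d≡x = m+[n∸m]≡n c≤x
    d<k = +-cancelˡ-< c d k (subst (_< c + k) (sym c+d≡x) x<c+k)
    d≮r : ¬ d < r
    d≮r d<r = <⇒≱ (subst (d <_) r≡0 d<r) z≤n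
  ... | inj₂ (_ , wrap) = r + d , r+d<k , sym (trans (entry-unwrapped (λ r+d<r → <⇒≱ r+d<r (m≤m+n r d)))
                                                     (trans (cong (c +_) (m+n∸m≡n r d)) c+d≡x))
    where
    d = x ∸ c
    c+d≡x = m+[n∸m]≡n c≤x
    r+d<k : r + d < k
    r+d<k = +-cancelˡ-< c (r + d) k (subst (_< c + k) (sym (trans (shift₂ c r d) (cong (r +_) c+d≡x)))
              (subst (r + x <_) (trans (+-comm r (suc n)) (sym wrap)) (+-monoʳ-< r (s≤s x≤n))))

  entries⊆interval : ∀ l → l < k → Bounded n (entry l) × InInterval (entry l)
  entries⊆interval l l<k with l <? r
  ... | yes l<r = (s≤s z≤n , ≤-trans l<r (<⇒≤ r<n)) , inj₂ (subst₂ _<_ (sym (shift₁ l n)) (sym wrap) (+-monoʳ-< (suc n) l<r))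
    where
    wrap = wrap-equation (≤-<-trans z≤n l<r)
    r<n : r < n
    r<n = <-trans (n<1+n r) (+-cancelʳ-< n (suc r) n (subst (_< n + n) (sym (shift₁ r n)) (subst (_< n + n) wrap (+-mono-≤-< c≤n k<n))))
  ... | no l≮r = (≤-trans 1≤c (m≤m+n c d) , c+d≤n) , inj₁ (m≤m+n c d , +-monoʳ-< c (≤-<-trans (m∸n≤m l r) l<k))
    where
    d = l ∸ r
    r+d≡l : r + d ≡ l
    r+d≡l = m+[n∸m]≡n (≮⇒≥ l≮r)
    c+d≤n : c + d ≤ n
    c+d≤n with wraps
    ... | inj₁ (_ , c+k≤1+n) = ≤-pred (<-≤-trans (+-monoʳ-< c (≤-<-trans (m∸n≤m l r) l<k)) c+k≤1+n)
    ... | inj₂ (_ , wrap) = ≤-pred (+-cancelʳ-< r (c + d) (suc n)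
            (subst₂ _<_ (trans (cong (c +_) (sym r+d≡l)) (shift₃ c r d)) wrap (+-monoʳ-< c l<k)))

  entry-succ : ∀ {l} → ¬ suc l ≡ r → entry (suc l) ≡ suc (entry l)
  entry-succ {l} l+1≢r with <-cmp (suc l) r
  ... | tri< l+1<r _ _ = trans (entry-wrapped l+1<r) (cong suc (sym (entry-wrapped (<-trans (n<1+n l) l+1<r))))
  ... | tri≈ _ l+1≡r _ = ⊥-elim (l+1≢r l+1≡r)
  ... | tri> _ _ r<l+1 = begin
    entry (suc l)        ≡⟨ entry-unwrapped (<-asym r<l+1) ⟩
    c + (suc l ∸ r)      ≡⟨ cong (c +_) (+-∸-assoc 1 r≤l) ⟩
    c + suc (l ∸ r)      ≡⟨ +-suc c (l ∸ r) ⟩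
    suc (c + (l ∸ r))    ≡⟨ cong suc (sym (entry-unwrapped (λ l<r → <⇒≱ l<r r≤l))) ⟩
    suc (entry l)        ∎
    where
    open ≡-Reasoning
    r≤l = ≤-pred r<l+1

  entry-mono : ∀ l → suc l < k → entry l < entry (suc l)
  entry-mono l _ with suc l ≟ r
  ... | no l+1≢r = subst (entry l <_) (sym (entry-succ l+1≢r)) (n<1+n (entry l))
  ... | yes l+1≡r = subst₂ _<_ (sym (entry-wrapped l<r)) (sym (entry-unwrapped (<-irrefl l+1≡r)))
                             (<-≤-trans r<c (m≤m+n c _))
    where
    l<r = subst (l <_) l+1≡r (n<1+n l)
    wrap = wrap-equation (≤-<-trans z≤n l<r)
    r<c : suc l < c
    r<c = subst (_< c) (sym l+1≡r) (+-cancelˡ-< (suc n) r c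
            (subst (_< suc n + c) wrap (subst (c + k <_) (+-comm c (suc n)) (+-monoʳ-< c (m≤n⇒m≤1+n k<n)))))

  entries : List ℕ
  entries = applyUpTo entry k

  -- At the wrap-around, 1, ..., r is the smallest possible prefix and
  -- c, ..., n the largest possible suffix of a vertex.
  wrap-extremal : ∀ l → suc l < k → suc l ≡ r → ExtremalStep k n entries l
  wrap-extremal l l+1<k l+1≡r = prefix-min , suffix-max
    where
    wrap = wrap-equation (subst (0 <_) l+1≡r (s≤s z≤n))
    prefix-min : ∀ m → m ≤ l → ∀ I → V k n I → at entries m ≤ at I m
    prefix-min m m≤l I vI = subst (_≤ at I m) (sym (trans (at-applyUpTo entry k m m<k) (entry-wrapped m<r))) (entry-≥ vI m m<k)
      where
      m<r = subst (m <_) l+1≡r (s≤s m≤l)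
      m<k = ≤-<-trans m≤l (<-trans (n<1+n l) l+1<k)
    suffix-max : ∀ m → l < m → m < k → ∀ I → V k n I → at I m ≤ at entries m
    suffix-max m l<m m<k I vI =
      subst (at I m ≤_) (sym (trans (at-applyUpTo entry k m m<k) (entry-unwrapped (λ m<r → <⇒≱ m<r r≤m))))
        (+-cancelʳ-≤ e (at I m) (c + d) (subst (at I m + e ≤_) (sym c+d+e≡n) (entry-≤ vI m m<k)))
      where
      r≤m = subst (_≤ m) l+1≡r l<m
      d = m ∸ r
      e = k ∸ suc m
      c+d+e≡n : (c + d) + e ≡ n
      c+d+e≡n = suc-injective (+-cancelʳ-≡ r (suc (c + d + e)) (suc n)
                  (trans (sym (shift₄ c r d e))
                  (trans (cong (λ t → c + (suc t + e)) (m+[n∸m]≡n r≤m))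
                  (trans (cong (c +_) (m+[n∸m]≡n m<k)) wrap))))

  steps : UnitOrExtremal k n entries
  steps l l+1<k with suc l ≟ r
  ... | yes l+1≡r = inj₂ (wrap-extremal l l+1<k l+1≡r)
  ... | no l+1≢r = inj₁ (trans (at-applyUpTo entry k (suc l) l+1<k)
                        (trans (entry-succ l+1≢r) (cong suc (sym (at-applyUpTo entry k l (<-trans (n<1+n l) l+1<k))))))

  cycInt≡entries : cycInt k n c ≡ entries
  cycInt≡entries = increasing-ext (increasing-filter inInterval? (increasing-range1 n)) (applyUpTo⁺₁ entry k (entry-mono _))
    (λ z z∈ → let z∈[n] , inI = ∈-filter⁻ inInterval? {xs = range1 n} z∈
                  l , l<k , z≡ = interval⊆entries z (∈-range1⁻ z∈[n]) inI
              in subst (_∈ entries) (sym z≡) (∈-applyUpTo⁺ entry l<k))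
    (λ z z∈ → let l , l<k , z≡ = ∈-applyUpTo⁻ entry z∈ ; bz , inI = entries⊆interval l l<k
              in subst (_∈ cycInt k n c) (sym z≡) (∈-filter⁺ inInterval? (∈-range1⁺ bz) inI))
    where
    inInterval? = λ x → ((c ≤? x) ×-dec (x <? c + k)) ⊎-dec (x + n <? c + k)

  V-entries : V k n entries
  V-entries = length-applyUpTo entry k , applyUpTo⁺₁ entry k (entry-mono _) ,
              All.tabulate (λ z∈ → let l , l<k , z≡ = ∈-applyUpTo⁻ entry z∈ in subst (Bounded n) (sym z≡) (proj₁ (entries⊆interval l l<k)))

  V-cycInt : V k n (cycInt k n c)
  V-cycInt = subst (V k n) (sym cycInt≡entries) V-entries

  nc-cycInt : ∀ I → V k n I → NC (cycInt k n c) I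
  nc-cycInt I vI = subst (λ C → NC C I) (sym cycInt≡entries) (noncrossing-extremal entries (length-applyUpTo entry k) steps vI)

universal∈maximal : ∀ {k n C} → V k n C → (∀ I → V k n I → NC C I) → ∀ F → MaximalFace k n F → C ∈ F
universal∈maximal vC nc F ((vF , ncF) , maximal) = maximal _ vC (vC ∷ vF , All.map (nc _) vF ∷ ncF)

proposition1p8 : (k n : ℕ) → 1 ≤ k → k < n →
    -- (i)
    SimplicialIso (V k n) (V k n) (revComp n)
    -- (ii)
    × SimplicialIso (V k n) (V (n ∸ k) n) (compl n)
    -- (iii)
    × (∀ I J → V k n I → V k n J →
        (NC I J ⇔ NC (relabel (symDiff n I J) (diff I J)) (relabel (symDiff n I J) (diff J I))))
    -- (iv)
    × (∀ b → 1 ≤ b → b ≤ n →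
        SimplicialIso (λ I → V k n I × b ∈ I) (V (k ∸ 1) (n ∸ 1)) (delete b)
        × SimplicialIso (λ I → V k n I × b ∉ I) (V k (n ∸ 1)) (delete b))
    -- (v)
    × (∀ c → 1 ≤ c → c ≤ n →
        V k n (cycInt k n c)
        × (∀ I → V k n I → NC (cycInt k n c) I)
        × (∀ F → MaximalFace k n F → cycInt k n c ∈ F))
proposition1p8 (suc k) (suc m) _ k<n =
  Reflection.revComp-iso (suc m) (suc k) ,
  compl-iso (suc k) (suc m) (<⇒≤ k<n) ,
  nc⇔restricted ,
  (λ b 1≤b b≤n → let open Deletion b in delete-iso∈ 1≤b b≤n k , delete-iso∉ 1≤b b≤n (suc k)) ,
  (λ c 1≤c c≤n → let open CyclicInterval (suc k) (suc m) c 1≤c c≤n k<n in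
                 V-cycInt , nc-cycInt , universal∈maximal V-cycInt nc-cycInt)
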